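{- Let $x\in\mathcal{A}$ be a letter whose stabilizer $G_x$ has maximal order among all letters. Then the greatest expected wait time of a pattern of length $\ell$ is $$\frac{|G_x|}{|G|}\,(q+q^2+\dots+q^\ell),$$ and it is achieved by the pattern $xx\cdots x$ (of length $\ell$).
   Context: Let $\mathcal{A}$ be a finite alphabet with $q\ge 2$ letters and $G$ a subgroup of the symmetric group on $\mathcal{A}$, acting on words letterwise. A pattern is a $G$-orbit of words. The expected wait time of a pattern $p$ is the expected number of letters drawn independently and uniformly at random from $\mathcal{A}$ until the drawn sequence first ends with a word belonging to the orbit $p$. -}

module Defs where

open import Data.Bool.Base using (Bool; _∧_; not)
open import Data.Nat.Base as ℕ using (ℕ; zero; suc; _^_; _∸_; _≤ᵇ_; NonZero)
open import Data.Nat.Properties using (m^n≢0)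
open import Data.Fin.Base using (Fin)
open import Data.Fin.Properties using (_≟_)
open import Data.Fin.Permutation using (Permutation′; _⟨$⟩ʳ_; _≈_; id; flip; _∘ₚ_)
open import Data.List.Base using (List; []; _∷_; [_]; map; length; drop; take; upTo; allFin; concatMap; filterᵇ; filter; foldr)
open import Data.Bool.ListAction using (any)
open import Data.Nat.ListAction using (sum)
open import Data.List.Properties using (≡-dec)
open import Data.List.Relation.Unary.Any using (Any)
open import Data.List.Relation.Unary.AllPairs using (AllPairs)
open import Data.List.Membership.Propositional using (_∈_)
open import Data.Integer.Base using (+_)
open import Data.Rational.Base using (ℚ; _/_; _+_; _*_; _-_; ∣_∣; _<_; 0ℚ; 1ℚ)
open import Data.Product.Base using (∃; _×_)
open import Relation.Nullary using (¬_; does)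

-- Words over the alphabet A = Fin q (first drawn letter first).
Word : ℕ → Set
Word q = List (Fin q)

act : ∀ {q} → Permutation′ q → Word q → Word q
act g = map (g ⟨$⟩ʳ_)

record FiniteSubgroup (q : ℕ) : Set where
  field
    elems      : List (Permutation′ q)
    distinct   : AllPairs (λ g h → ¬ (g ≈ h)) elems
    has-id     : Any (λ g → g ≈ id) elems
    closed-∘   : ∀ {g h} → g ∈ elems → h ∈ elems → Any (λ k → k ≈ (g ∘ₚ h)) elems
    closed-inv : ∀ {g} → g ∈ elems → Any (λ k → k ≈ flip g) elems
open FiniteSubgroup public

order : ∀ {q} → FiniteSubgroup q → ℕ
order G = length (elems G)

order-nonZero : ∀ {q} (G : FiniteSubgroup q) → NonZero (order G)
order-nonZero G with elems G | has-id G
... | _ ∷ _ | _ = _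

stabOrder : ∀ {q} → FiniteSubgroup q → Fin q → ℕ
stabOrder G x = length (filter (λ g → (g ⟨$⟩ʳ x) ≟ x) (elems G))

-- v lies in the G-orbit of w (the pattern represented by w)
inOrbit : ∀ {q} → FiniteSubgroup q → Word q → Word q → Bool
inOrbit G w v = any (λ g → does (≡-dec _≟_ (act g w) v)) (elems G)

endsInPattern : ∀ {q} → FiniteSubgroup q → Word q → Word q → Bool
endsInPattern G w u =
  (length w ≤ᵇ length u) ∧ inOrbit G w (drop (length u ∸ length w) u)

firstHit : ∀ {q} → FiniteSubgroup q → Word q → Word q → Bool
firstHit G w u =
  endsInPattern G w u ∧
  not (any (λ k → endsInPattern G w (take k u)) (upTo (length u)))

words : (q n : ℕ) → List (Word q)
words q zero = [ [] ]
words q (suc n) = concatMap (λ a → map (a ∷_) (words q n)) (allFin q)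

-- P(T = n), T the wait time, letters i.i.d. uniform on Fin q
probT : ∀ {q} .{{_ : NonZero q}} → FiniteSubgroup q → Word q → ℕ → ℚ
probT {q} G w n =
  _/_ (+ length (filterᵇ (firstHit G w) (words q n))) (q ^ n) {{m^n≢0 q n}}

Σℚ : ℕ → (ℕ → ℚ) → ℚ
Σℚ m f = foldr (λ n acc → f n + acc) 0ℚ (upTo m)

ConvergesTo : (ℕ → ℚ) → ℚ → Set
ConvergesTo s r =
  ∀ (ε : ℚ) → 0ℚ < ε → ∃ λ N → ∀ m → N ℕ.≤ m → ∣ s m - r ∣ < ε

-- E[T] = r : T is a.s. finite (Σ_n P(T=n) = 1) and Σ_n n·P(T=n) = r
ExpectedWait : ∀ {q} .{{_ : NonZero q}} → FiniteSubgroup q → Word q → ℚ → Set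
ExpectedWait G w r =
  ConvergesTo (λ m → Σℚ m (probT G w)) 1ℚ ×
  ConvergesTo (λ m → Σℚ m (λ n → (+ n / 1) * probT G w n)) r

geomSum : ℕ → ℕ → ℕ
geomSum q ℓ = sum (map (λ i → q ^ suc i) (upTo ℓ))

bound : ∀ {q} → FiniteSubgroup q → Fin q → ℕ → ℚ
bound {q} G x ℓ =
  _/_ (+ stabOrder G x) (order G) {{order-nonZero G}} * (+ geomSum q ℓ / 1)

module Submission where

-- Let A n count the words of length n none of whose prefixes ends in the pattern (T > n) and H n those
-- in which the pattern occurs first at the end (T = n); then A (n + 1) + H (n + 1) = q · A n. Appending
-- g · w (g ∈ G) to a word counted by A n creates an occurrence, so exactly one extension by a prefix of
-- g · w is a first occurrence; summing over G gives |G| · A n = Σ_{j=1}^ℓ c_j · H (n + j), where c_j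
-- counts the g carrying the first j letters of w onto the last j. Dividing by q ^ n and summing over n
-- yields E[T] = (1/|G|) Σ_j c_j q ^ j, the series converging since A (n + ℓ) ≤ (q ^ ℓ − 1) · A n. Every
-- g counted by c_j sends the first letter of w to a prescribed letter, so c_j ≤ max_y |G_y| = |G_x|,
-- with equality for w = x ⋯ x.

open import Defs
open import Data.Bool.Base using (Bool; true; false; _∧_; _∨_; not; T)
open import Data.Bool.Properties using (∨-assoc; ∨-zeroʳ; ∨-identityʳ; ∨-conicalˡ; ∨-conicalʳ; ∧-zeroʳ; T-∧; T-≡)
open import Data.Bool.ListAction using (any; or)
open import Data.Empty using (⊥-elim)
open import Data.Fin.Base using (Fin) renaming (zero to fzero; suc to fsuc)
open import Data.Fin.Properties using (_≟_)
import Data.Fin.Properties as Fin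
open import Data.Fin.Permutation
  using (Permutation′; _⟨$⟩ʳ_; _⟨$⟩ˡ_; _≈_; id; flip; _∘ₚ_; inverseˡ)
open import Data.List.Base
  using (List; []; _∷_; [_]; _++_; map; length; take; drop; replicate; upTo; allFin; concatMap; filter; filterᵇ; foldr)
open import Data.List.Properties
  using (≡-dec; ∷-injectiveˡ; ∷-injectiveʳ; map-++; length-++; length-map; length-drop;
         length-replicate; length-tabulate; map-tabulate; map-applyUpTo; map-upTo;
         take-map; drop-map; drop-drop; drop-all; ++-identityʳ; foldr-++; upTo-∷ʳ; map-replicate; length-take)
open import Data.List.Membership.Propositional using (_∈_; find)
open import Data.List.Membership.Propositional.Properties
  using (∈-upTo⁻; ∈-map⁻; ∈-concatMap⁻; ∈-filter⁺)
open import Data.List.Relation.Unary.All as All using (All; []; _∷_)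
import Data.List.Relation.Unary.All.Properties as Allₚ
open import Data.List.Relation.Unary.Any as Any using (Any; here; there; any?)
open import Data.List.Relation.Unary.Any.Properties using (any⁺; any⁻)
open import Data.List.Relation.Unary.AllPairs as AllPairs using (AllPairs; []; _∷_)
import Data.List.Relation.Unary.AllPairs.Properties as AllPairsₚ
open import Data.Nat.Base hiding (_/_; _%_)
open import Data.Nat.DivMod using (_%_; m≡m%n+[m/n]*n; m%n<n; m*n/n≡m; /-mono-≤) renaming (_/_ to _div_)
open import Data.Nat.Properties hiding (_≟_)
open import Data.Nat.ListAction using (sum)
open import Data.Nat.ListAction.Properties using (sum-++)
open import Data.Nat.Solver using (module +-*-Solver)
open import Algebra.Properties.CommutativeSemigroup +-commutativeSemigroup using () renaming (interchange to +-interchange)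
open import Data.Integer.Base as ℤ using (+[1+_]; -[1+_])
import Data.Integer.Properties as ℤ
open import Data.Rational.Base as ℚ using (ℚ; mkℚ; 0ℚ; 1ℚ; _/_; ∣_∣; toℚᵘ)
import Data.Rational.Properties as ℚ
import Data.Rational.Unnormalised.Base as ℚᵘ
import Data.Rational.Unnormalised.Properties as ℚᵘ
open import Data.Rational.Solver using () renaming (module +-*-Solver to ℚ-Solver)
open import Data.Product.Base using (Σ; ∃; _×_; _,_; proj₁; proj₂)
open import Function.Base using (_∘_)
open import Relation.Binary.PropositionalEquality hiding ([_])
open import Relation.Nullary using (¬_; Dec; yes; no; does)
open import Relation.Nullary.Decidable using (dec-true; dec-false; does-⇔; T?)
open import Function.Bundles using (mk⇔; Equivalence)
open import Relation.Unary using (Decidable)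

-- Finite sums

𝟙 : Bool → ℕ
𝟙 true  = 1
𝟙 false = 0

T-does : ∀ {P : Set} (P? : Dec P) → T (does P?) → P
T-does (yes p) _ = p

does-T : ∀ {P : Set} (P? : Dec P) → P → T (does P?)
does-T (yes _) _ = _
does-T (no ¬p) p = ¬p p

𝟙-mono : ∀ {b b′} → (T b → T b′) → 𝟙 b ≤ 𝟙 b′
𝟙-mono {false}         _ = z≤n
𝟙-mono {true} {true}   _ = ≤-refl
𝟙-mono {true} {false} b⇒b′ = ⊥-elim (b⇒b′ _)

private variable A B : Set

∑ : List A → (A → ℕ) → ℕ
∑ xs f = sum (map f xs)

infix 5 ∑
syntax ∑ xs (λ x → e) = ∑[ x ← xs ] e

∑-++ : ∀ (xs ys : List A) f → ∑ (xs ++ ys) f ≡ ∑ xs f + ∑ ys f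
∑-++ xs ys f = trans (cong sum (map-++ f xs ys)) (sum-++ (map f xs) (map f ys))

∑-map : ∀ (h : A → B) xs f → ∑ (map h xs) f ≡ ∑ xs (f ∘ h)
∑-map h []       f = refl
∑-map h (x ∷ xs) f = cong (f (h x) +_) (∑-map h xs f)

∑-concatMap : ∀ (h : A → List B) xs f → ∑ (concatMap h xs) f ≡ ∑[ x ← xs ] ∑ (h x) f
∑-concatMap h []       f = refl
∑-concatMap h (x ∷ xs) f =
  trans (∑-++ (h x) (concatMap h xs) f) (cong (∑ (h x) f +_) (∑-concatMap h xs f))

∑-cong-∈ : ∀ (xs : List A) {f g : A → ℕ} → (∀ x → x ∈ xs → f x ≡ g x) → ∑ xs f ≡ ∑ xs g
∑-cong-∈ []       e = refl
∑-cong-∈ (x ∷ xs) e = cong₂ _+_ (e x (here refl)) (∑-cong-∈ xs (λ y y∈ → e y (there y∈)))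

∑-cong : ∀ (xs : List A) {f g : A → ℕ} → (∀ x → f x ≡ g x) → ∑ xs f ≡ ∑ xs g
∑-cong xs e = ∑-cong-∈ xs (λ x _ → e x)

∑-mono-∈ : ∀ (xs : List A) {f g : A → ℕ} → (∀ x → x ∈ xs → f x ≤ g x) → ∑ xs f ≤ ∑ xs g
∑-mono-∈ []       e = z≤n
∑-mono-∈ (x ∷ xs) e = +-mono-≤ (e x (here refl)) (∑-mono-∈ xs (λ y y∈ → e y (there y∈)))

∑-mono : ∀ (xs : List A) {f g : A → ℕ} → (∀ x → f x ≤ g x) → ∑ xs f ≤ ∑ xs g
∑-mono xs e = ∑-mono-∈ xs (λ x _ → e x)

∑-zero : ∀ (xs : List A) → ∑[ x ← xs ] 0 ≡ 0
∑-zero []       = refl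
∑-zero (x ∷ xs) = ∑-zero xs

∑-const : ∀ c (xs : List A) → ∑[ x ← xs ] c ≡ c * length xs
∑-const c []       = sym (*-zeroʳ c)
∑-const c (x ∷ xs) = trans (cong (c +_) (∑-const c xs)) (sym (*-suc c (length xs)))

∑-+ : ∀ (xs : List A) f g → ∑[ x ← xs ] (f x + g x) ≡ ∑ xs f + ∑ xs g
∑-+ []       f g = refl
∑-+ (x ∷ xs) f g = trans (cong (f x + g x +_) (∑-+ xs f g)) (+-interchange (f x) (g x) (∑ xs f) (∑ xs g))

∑-swap : ∀ (xs : List A) (ys : List B) (f : A → B → ℕ) →
  ∑[ x ← xs ] ∑ ys (f x) ≡ ∑[ y ← ys ] ∑[ x ← xs ] f x y
∑-swap []       ys f = sym (∑-zero ys)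
∑-swap (x ∷ xs) ys f = trans (cong (∑ ys (f x) +_) (∑-swap xs ys f)) (sym (∑-+ ys (f x) (λ y → ∑[ x ← xs ] f x y)))

∑-*ˡ : ∀ c (xs : List A) f → ∑[ x ← xs ] (c * f x) ≡ c * ∑ xs f
∑-*ˡ c []       f = sym (*-zeroʳ c)
∑-*ˡ c (x ∷ xs) f = trans (cong (c * f x +_) (∑-*ˡ c xs f)) (sym (*-distribˡ-+ c (f x) _))

length-filter≡∑ : ∀ {P : A → Set} (P? : Decidable P) xs → length (filter P? xs) ≡ ∑ xs (𝟙 ∘ does ∘ P?)
length-filter≡∑ P? []       = refl
length-filter≡∑ P? (x ∷ xs) with does (P? x)
... | true  = cong suc (length-filter≡∑ P? xs)
... | false = length-filter≡∑ P? xs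

map-upTo-suc : ∀ (h : ℕ → A) n → map h (upTo (suc n)) ≡ h 0 ∷ map (h ∘ suc) (upTo n)
map-upTo-suc h n = cong (h 0 ∷_) (trans (map-applyUpTo suc h n) (sym (map-upTo (h ∘ suc) n)))

∑-upTo-suc : ∀ n f → ∑ (upTo (suc n)) f ≡ f 0 + ∑ (upTo n) (f ∘ suc)
∑-upTo-suc n f = cong sum (map-upTo-suc f n)

∑-allFin-suc : ∀ n (f : Fin (suc n) → ℕ) → ∑ (allFin (suc n)) f ≡ f fzero + ∑ (allFin n) (f ∘ fsuc)
∑-allFin-suc n f =
  cong (f fzero +_) (trans (cong (λ xs → ∑ xs f) (sym (map-tabulate (λ i → i) fsuc))) (∑-map fsuc (allFin n) f))

∑-allFin-point : ∀ n (b : Fin n) (f : Fin n → ℕ) → (∀ a → a ≢ b → f a ≡ 0) → ∑ (allFin n) f ≡ f b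
∑-allFin-point (suc n) fzero f off = trans (∑-allFin-suc n f)
  (trans (cong (f fzero +_) (trans (∑-cong (allFin n) (λ a → off (fsuc a) λ ())) (∑-zero (allFin n))))
    (+-identityʳ (f fzero)))
∑-allFin-point (suc n) (fsuc b) f off = trans (∑-allFin-suc n f)
  (trans (cong (_+ ∑ (allFin n) (f ∘ fsuc)) (off fzero λ ()))
    (∑-allFin-point n b (f ∘ fsuc) (λ a a≢b → off (fsuc a) (a≢b ∘ Fin.suc-injective))))

∈-words⁻ : ∀ {q} n {u : Word q} → u ∈ words q n → length u ≡ n
∈-words⁻ zero (here refl) = refl
∈-words⁻ {q} (suc n) u∈ with a , u∈a ← Any.satisfied (∈-concatMap⁻ _ {xs = allFin q} u∈)
  with v , v∈ , refl ← ∈-map⁻ (a ∷_) u∈a = cong suc (∈-words⁻ n v∈)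

module WordSums (q : ℕ) where

  ∑ʷ : ℕ → (Word q → ℕ) → ℕ
  ∑ʷ n f = ∑ (words q n) f

  ∑ʷ-cong : ∀ n {f g : Word q → ℕ} → (∀ u → length u ≡ n → f u ≡ g u) → ∑ʷ n f ≡ ∑ʷ n g
  ∑ʷ-cong n e = ∑-cong-∈ (words q n) (λ u u∈ → e u (∈-words⁻ n u∈))

  ∑ʷ-mono : ∀ n {f g : Word q → ℕ} → (∀ u → length u ≡ n → f u ≤ g u) → ∑ʷ n f ≤ ∑ʷ n g
  ∑ʷ-mono n e = ∑-mono-∈ (words q n) (λ u u∈ → e u (∈-words⁻ n u∈))

  ∑ʷ-suc : ∀ n f → ∑ʷ (suc n) f ≡ ∑[ a ← allFin q ] ∑ʷ n (λ u → f (a ∷ u))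
  ∑ʷ-suc n f = trans (∑-concatMap (λ a → map (a ∷_) (words q n)) (allFin q) f)
    (∑-cong (allFin q) (λ a → ∑-map (a ∷_) (words q n) f))

  ∑ʷ-++ : ∀ n m f → ∑ʷ (n + m) f ≡ ∑ʷ n (λ u → ∑ʷ m (λ v → f (u ++ v)))
  ∑ʷ-++ zero    m f = sym (+-identityʳ _)
  ∑ʷ-++ (suc n) m f = trans (∑ʷ-suc (n + m) f)
    (trans (∑-cong (allFin q) (λ a → ∑ʷ-++ n m (λ u → f (a ∷ u)))) (sym (∑ʷ-suc n _)))

  length-words : ∀ n → length (words q n) ≡ q ^ n
  length-words zero    = refl
  length-words (suc n) = begin
    length (words q (suc n))                      ≡⟨ sym (trans (∑-const 1 (words q (suc n))) (*-identityˡ _)) ⟩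
    ∑ʷ (suc n) (λ _ → 1)                           ≡⟨ ∑ʷ-suc n (λ _ → 1) ⟩
    ∑[ a ← allFin q ] ∑ʷ n (λ _ → 1)              ≡⟨ ∑-cong (allFin q) (λ _ → ∑-const 1 (words q n)) ⟩
    ∑[ a ← allFin q ] (1 * length (words q n))    ≡⟨ ∑-const _ (allFin q) ⟩
    1 * length (words q n) * length (allFin q)    ≡⟨ cong₂ (λ x y → 1 * x * y) (length-words n) (length-tabulate (λ i → i)) ⟩
    1 * q ^ n * q                                 ≡⟨ trans (cong (_* q) (*-identityˡ (q ^ n))) (*-comm (q ^ n) q) ⟩
    q ^ suc n                                     ∎
    where open ≡-Reasoning

  ∑ʷ-const : ∀ n c → ∑ʷ n (λ _ → c) ≡ c * q ^ n
  ∑ʷ-const n c = trans (∑-const c (words q n)) (cong (c *_) (length-words n))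

  ∑ʷ-point : ∀ n (p : Word q) (f : Word q → ℕ) → length p ≡ n →
    (∀ t → length t ≡ n → t ≢ p → f t ≡ 0) → ∑ʷ n f ≡ f p
  ∑ʷ-point zero    []      f _ _   = +-identityʳ (f [])
  ∑ʷ-point (suc n) (b ∷ p) f |p| off = trans (∑ʷ-suc n f)
    (trans (∑-allFin-point q b _ other-heads) (∑ʷ-point n p (f ∘ (b ∷_)) (suc-injective |p|) same-head))
    where
    other-heads : ∀ a → a ≢ b → ∑ʷ n (λ u → f (a ∷ u)) ≡ 0
    other-heads a a≢b =
      trans (∑ʷ-cong n (λ u |u| → off (a ∷ u) (cong suc |u|) (a≢b ∘ ∷-injectiveˡ))) (∑-zero (words q n))
    same-head : ∀ t → length t ≡ n → t ≢ p → f (b ∷ t) ≡ 0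
    same-head t |t| t≢p = off (b ∷ t) (cong suc |t|) (t≢p ∘ ∷-injectiveʳ)

-- Counting group elements

module _ {A : Set} (_~_ : A → A → Set)
         (~-sym : ∀ {a b} → a ~ b → b ~ a) (~-trans : ∀ {a b c} → a ~ b → b ~ c → a ~ c) where

  private
    remove : ∀ {x} (ys : List A) → Any (x ~_) ys → List A
    remove (_ ∷ ys) (here _)    = ys
    remove (y ∷ ys) (there x∈) = y ∷ remove ys x∈

    length-remove : ∀ {x} ys (x∈ : Any (x ~_) ys) → length ys ≡ suc (length (remove ys x∈))
    length-remove (_ ∷ ys) (here _)    = refl
    length-remove (y ∷ ys) (there x∈) = cong suc (length-remove ys x∈)

    ∈-remove : ∀ {x x′} ys (x∈ : Any (x ~_) ys) → Any (x′ ~_) ys → ¬ x ~ x′ → Any (x′ ~_) (remove ys x∈)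
    ∈-remove (_ ∷ _)  (here x~y)  (here x′~y)   x≁x′ = ⊥-elim (x≁x′ (~-trans x~y (~-sym x′~y)))
    ∈-remove (_ ∷ _)  (here _)    (there x′∈)   _    = x′∈
    ∈-remove (_ ∷ _)  (there _)   (here x′~y)   _    = here x′~y
    ∈-remove (_ ∷ ys) (there x∈) (there x′∈)  x≁x′ = there (∈-remove ys x∈ x′∈ x≁x′)

  pigeonhole : ∀ {xs ys : List A} → AllPairs (λ a b → ¬ a ~ b) xs → All (λ x → Any (x ~_) ys) xs →
    length xs ≤ length ys
  pigeonhole {[]}             []            []          = z≤n
  pigeonhole {x ∷ xs} {ys} (x≁xs ∷ xs-distinct) (x∈ ∷ xs∈) = subst (suc (length xs) ≤_) (sym (length-remove ys x∈))
    (s≤s (pigeonhole xs-distinct (All.zipWith (λ (x′∈ , x≁x′) → ∈-remove ys x∈ x′∈ x≁x′) (xs∈ , x≁xs))))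

infix 4 _=ʷ_

_=ʷ_ : ∀ {q} → Word q → Word q → Bool
u =ʷ v = does (≡-dec _≟_ u v)

module _ {q : ℕ} where

  act-cong : ∀ {g h : Permutation′ q} → g ≈ h → ∀ u → act g u ≡ act h u
  act-cong         g≈h []      = refl
  act-cong {g} {h} g≈h (a ∷ u) = cong₂ _∷_ (g≈h a) (act-cong {g} {h} g≈h u)

  act-∘ₚ : ∀ (g h : Permutation′ q) u → act (g ∘ₚ h) u ≡ act h (act g u)
  act-∘ₚ g h []      = refl
  act-∘ₚ g h (a ∷ u) = cong (_ ∷_) (act-∘ₚ g h u)

  act-flip : ∀ (h : Permutation′ q) u → act (flip h) (act h u) ≡ u
  act-flip h []      = refl
  act-flip h (a ∷ u) = cong₂ _∷_ (inverseˡ h) (act-flip h u)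

  act-id : ∀ (u : Word q) → act id u ≡ u
  act-id []      = refl
  act-id (a ∷ u) = cong (a ∷_) (act-id u)

  act-injective : ∀ (h : Permutation′ q) {u v} → act h u ≡ act h v → u ≡ v
  act-injective h {u} {v} e = trans (sym (act-flip h u)) (trans (cong (act (flip h)) e) (act-flip h v))

  =ʷ-act : ∀ (h : Permutation′ q) u v → (act h u =ʷ act h v) ≡ (u =ʷ v)
  =ʷ-act h u v = does-⇔ (mk⇔ (act-injective h) (cong (act h))) (≡-dec _≟_ _ _) (≡-dec _≟_ u v)

  replicate-=ʷ : ∀ n (y x : Fin q) → (replicate (suc n) y =ʷ replicate (suc n) x) ≡ does (y ≟ x)
  replicate-=ʷ n y x =
    does-⇔ (mk⇔ ∷-injectiveˡ (cong (λ z → replicate (suc n) z))) (≡-dec _≟_ _ _) (y ≟ x)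

  length-act : ∀ (g : Permutation′ q) u → length (act g u) ≡ length u
  length-act g = length-map (g ⟨$⟩ʳ_)

module Counting {q : ℕ} (G : FiniteSubgroup q) where

  private
    Perm = Permutation′ q
    S = elems G

    ≈-sym : ∀ {g h : Perm} → g ≈ h → h ≈ g
    ≈-sym e i = sym (e i)

    ≈-trans : ∀ {f g h : Perm} → f ≈ g → g ≈ h → f ≈ h
    ≈-trans e e′ i = trans (e i) (e′ i)

  count : (Perm → Bool) → ℕ
  count C = ∑ S (𝟙 ∘ C)

  count-∘ₚ-≤ : ∀ {h} → h ∈ S → (C : Perm → Bool) → (∀ {g g′} → g ≈ g′ → C g ≡ C g′) →
    count (C ∘ (_∘ₚ h)) ≤ count C
  count-∘ₚ-≤ {h} h∈ C C-resp = subst₂ _≤_ |images| |targets|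
    (pigeonhole (_≈_ {q}) (λ {g h} → ≈-sym {g} {h}) (λ {f g h} → ≈-trans {f} {g} {h}) images-distinct images-covered)
    where
    sources targets images : List Perm
    sources = filterᵇ (C ∘ (_∘ₚ h)) S
    targets = filterᵇ C S
    images  = map (_∘ₚ h) sources

    |images| : length images ≡ count (C ∘ (_∘ₚ h))
    |images| = trans (length-map (_∘ₚ h) sources) (length-filter≡∑ (T? ∘ C ∘ (_∘ₚ h)) S)

    |targets| : length targets ≡ count C
    |targets| = length-filter≡∑ (T? ∘ C) S

    ∘ₚ-cancel : ∀ {g g′ : Perm} → ¬ g ≈ g′ → ¬ (g ∘ₚ h) ≈ (g′ ∘ₚ h)
    ∘ₚ-cancel g≉g′ e = g≉g′ λ i → trans (sym (inverseˡ h)) (trans (cong (h ⟨$⟩ˡ_) (e i)) (inverseˡ h))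

    images-distinct : AllPairs (λ g g′ → ¬ g ≈ g′) images
    images-distinct = AllPairsₚ.map⁺ (AllPairsₚ.filter⁺ (T? ∘ C ∘ (_∘ₚ h))
      (AllPairs.map (λ {g g′} → ∘ₚ-cancel {g} {g′}) (distinct G)))

    image∈ : ∀ {g} → g ∈ S × T (C (g ∘ₚ h)) → Any ((g ∘ₚ h) ≈_) targets
    image∈ {g} (g∈ , Cgh) with k , k∈ , k≈gh ← find (closed-∘ G g∈ h∈) =
      Any.map (λ { refl → ≈-sym {k} {g ∘ₚ h} k≈gh }) (∈-filter⁺ (T? ∘ C) k∈ (subst T (sym (C-resp k≈gh)) Cgh))

    images-covered : All (λ g → Any (g ≈_) targets) images
    images-covered = Allₚ.map⁺ (All.map image∈
      (All.zip (Allₚ.filter⁺ (T? ∘ C ∘ (_∘ₚ h)) (All.tabulate (λ g∈ → g∈)) , Allₚ.all-filter _ S)))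

  #⟦_↦_⟧ : Word q → Word q → ℕ
  #⟦ p ↦ s ⟧ = count (λ g → act g p =ʷ s)

  ↦-translate-≤ : ∀ {h} → h ∈ S → ∀ p s → #⟦ p ↦ s ⟧ ≤ #⟦ p ↦ act h s ⟧
  ↦-translate-≤ {h} h∈ p s = subst (_≤ #⟦ p ↦ act h s ⟧) (∑-cong S (cong 𝟙 ∘ translated))
    (count-∘ₚ-≤ h∈ (λ g → act g p =ʷ act h s) (λ {g g′} g≈g′ → cong (_=ʷ act h s) (act-cong {g = g} {g′} g≈g′ p)))
    where
    translated : ∀ g → (act (g ∘ₚ h) p =ʷ act h s) ≡ (act g p =ʷ s)
    translated g = trans (cong (_=ʷ act h s) (act-∘ₚ g h p)) (=ʷ-act h (act g p) s)

  ↦-translate : ∀ {h} → h ∈ S → ∀ p s → #⟦ p ↦ act h s ⟧ ≡ #⟦ p ↦ s ⟧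
  ↦-translate {h} h∈ p s with k , k∈ , k≈h⁻¹ ← find (closed-inv G h∈) =
    ≤-antisym (subst (#⟦ p ↦ act h s ⟧ ≤_) back (↦-translate-≤ k∈ p (act h s))) (↦-translate-≤ h∈ p s)
    where
    back : #⟦ p ↦ act k (act h s) ⟧ ≡ #⟦ p ↦ s ⟧
    back = cong #⟦ p ↦_⟧ (trans (act-cong {g = k} {h = flip h} k≈h⁻¹ (act h s)) (act-flip h s))

  ↦-≤-self : ∀ p s → #⟦ p ↦ s ⟧ ≤ #⟦ p ↦ p ⟧
  ↦-≤-self p s with any? (λ g → ≡-dec _≟_ (act g p) s) S
  ... | yes ∃g with g , g∈ , refl ← find ∃g = ≤-reflexive (↦-translate g∈ p p)
  ... | no ∄g = subst (_≤ #⟦ p ↦ p ⟧) (sym (trans (∑-cong-∈ S unreachable) (∑-zero S))) z≤n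
    where
    unreachable : ∀ g → g ∈ S → 𝟙 (act g p =ʷ s) ≡ 0
    unreachable g g∈ = cong 𝟙 (dec-false (≡-dec _≟_ (act g p) s) (λ e → ∄g (Any.map (λ { refl → e }) g∈)))

  ↦-replicate : ∀ n x → #⟦ replicate (suc n) x ↦ replicate (suc n) x ⟧ ≡ stabOrder G x
  ↦-replicate n x = trans (∑-cong S (cong 𝟙 ∘ fixes)) (sym (length-filter≡∑ (λ g → (g ⟨$⟩ʳ x) ≟ x) S))
    where
    fixes : ∀ g → (act g (replicate (suc n) x) =ʷ replicate (suc n) x) ≡ does ((g ⟨$⟩ʳ x) ≟ x)
    fixes g = trans (cong (_=ʷ replicate (suc n) x) (map-replicate (g ⟨$⟩ʳ_) (suc n) x))
                    (replicate-=ʷ n (g ⟨$⟩ʳ x) x)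

  ↦-head-≤ : ∀ a p s → 0 < length s → #⟦ a ∷ p ↦ s ⟧ ≤ stabOrder G a
  ↦-head-≤ a p (b ∷ s) _ = begin
    #⟦ a ∷ p ↦ b ∷ s ⟧ ≤⟨ ∑-mono S (λ g → 𝟙-mono (head-maps g)) ⟩
    #⟦ [ a ] ↦ [ b ] ⟧ ≤⟨ ↦-≤-self [ a ] [ b ] ⟩
    #⟦ [ a ] ↦ [ a ] ⟧ ≡⟨ ↦-replicate 0 a ⟩
    stabOrder G a      ∎
    where
    open ≤-Reasoning
    head-maps : ∀ g → T (act g (a ∷ p) =ʷ b ∷ s) → T (act g [ a ] =ʷ [ b ])
    head-maps g e = does-T (≡-dec _≟_ (act g [ a ]) [ b ])
      (cong [_] (∷-injectiveˡ (T-does (≡-dec _≟_ (act g (a ∷ p)) (b ∷ s)) e)))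

-- Prefixes and suffixes

anyProperPrefix : (List A → Bool) → List A → Bool
anyProperPrefix F []      = false
anyProperPrefix F (a ∷ u) = F [] ∨ anyProperPrefix (F ∘ (a ∷_)) u

anyPrefix : (List A → Bool) → List A → Bool
anyPrefix F u = anyProperPrefix F u ∨ F u

firstPrefix : (List A → Bool) → List A → Bool
firstPrefix F u = F u ∧ not (anyProperPrefix F u)

any-take≡anyProperPrefix : ∀ (F : List A → Bool) u →
  any (λ k → F (take k u)) (upTo (length u)) ≡ anyProperPrefix F u
any-take≡anyProperPrefix F []      = refl
any-take≡anyProperPrefix F (a ∷ u) = trans (cong or (map-upTo-suc (λ k → F (take k (a ∷ u))) (length u)))
  (cong (F [] ∨_) (any-take≡anyProperPrefix (F ∘ (a ∷_)) u))

anyProperPrefix-++ : ∀ (F : List A → Bool) u t →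
  anyProperPrefix F (u ++ t) ≡ anyProperPrefix F u ∨ anyProperPrefix (λ z → F (u ++ z)) t
anyProperPrefix-++ F []      t = refl
anyProperPrefix-++ F (a ∷ u) t =
  trans (cong (F [] ∨_) (anyProperPrefix-++ (F ∘ (a ∷_)) u t)) (sym (∨-assoc (F []) _ _))

anyProperPrefix-∷ʳ : ∀ (F : List A → Bool) u b → anyProperPrefix F (u ++ [ b ]) ≡ anyPrefix F u
anyProperPrefix-∷ʳ F []      b = ∨-identityʳ (F [])
anyProperPrefix-∷ʳ F (a ∷ u) b =
  trans (cong (F [] ∨_) (anyProperPrefix-∷ʳ (F ∘ (a ∷_)) u b)) (sym (∨-assoc (F []) _ _))

∑-firstPrefix : ∀ (F : List A → Bool) v →
  ∑[ k ← upTo (suc (length v)) ] 𝟙 (firstPrefix F (take k v)) ≡ 𝟙 (anyPrefix F v)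
∑-firstPrefix F [] with F []
... | true  = refl
... | false = refl
∑-firstPrefix F (a ∷ v) =
  trans (∑-upTo-suc (suc (length v)) (λ k → 𝟙 (firstPrefix F (take k (a ∷ v))))) (after-head (F []))
  where
  after-head : ∀ b → 𝟙 (b ∧ true) + (∑[ k ← upTo (suc (length v)) ]
                        𝟙 (F (a ∷ take k v) ∧ not (b ∨ anyProperPrefix (F ∘ (a ∷_)) (take k v))))
                     ≡ 𝟙 ((b ∨ anyProperPrefix (F ∘ (a ∷_)) v) ∨ F (a ∷ v))
  after-head true  = cong suc (trans (∑-cong (upTo (suc (length v))) (λ k → cong 𝟙 (∧-zeroʳ (F (a ∷ take k v)))))
                                     (∑-zero (upTo (suc (length v)))))
  after-head false = ∑-firstPrefix (F ∘ (a ∷_)) v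

¬anyPrefix-∷ʳ : ∀ (F : List A → Bool) u b →
  𝟙 (not (anyPrefix F (u ++ [ b ]))) + 𝟙 (firstPrefix F (u ++ [ b ])) ≡ 𝟙 (not (anyPrefix F u))
¬anyPrefix-∷ʳ F u b rewrite anyProperPrefix-∷ʳ F u b = split (anyPrefix F u) (F (u ++ [ b ]))
  where
  split : ∀ p c → 𝟙 (not (p ∨ c)) + 𝟙 (c ∧ not p) ≡ 𝟙 (not p)
  split true  c     = cong 𝟙 (∧-zeroʳ c)
  split false true  = refl
  split false false = refl

∑-firstPrefix-++ : ∀ {A : Set} (F : List A → Bool) u b v → F (u ++ b ∷ v) ≡ true →
  ∑[ k ← upTo (suc (length v)) ] 𝟙 (firstPrefix F (u ++ take (suc k) (b ∷ v))) ≡ 𝟙 (not (anyPrefix F u))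
∑-firstPrefix-++ {A} F u b v F[u++b∷v] = begin
  ∑[ k ← ks ] 𝟙 (firstPrefix F (u ++ b ∷ take k v))
    ≡⟨ ∑-cong ks (λ k → cong (λ x → 𝟙 (F′ (take k v) ∧ not x)) (anyProperPrefix-++ F u (b ∷ take k v))) ⟩
  ∑[ k ← ks ] 𝟙 (F′ (take k v) ∧ not (anyProperPrefix F u ∨ (F (u ++ []) ∨ anyProperPrefix F′ (take k v))))
    ≡⟨ from-u (anyProperPrefix F u) (F (u ++ [])) ⟩
  𝟙 (not (anyProperPrefix F u ∨ F (u ++ [])))
    ≡⟨ cong (λ x → 𝟙 (not (anyProperPrefix F u ∨ F x))) (++-identityʳ u) ⟩
  𝟙 (not (anyPrefix F u)) ∎
  where
  open ≡-Reasoning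
  ks = upTo (suc (length v))
  F′ : List A → Bool
  F′ z = F (u ++ b ∷ z)

  vanishes : ∑[ k ← ks ] 𝟙 (F′ (take k v) ∧ false) ≡ 0
  vanishes = trans (∑-cong ks (λ k → cong 𝟙 (∧-zeroʳ (F′ (take k v))))) (∑-zero ks)

  from-u : ∀ p e → ∑[ k ← ks ] 𝟙 (F′ (take k v) ∧ not (p ∨ (e ∨ anyProperPrefix F′ (take k v))))
                   ≡ 𝟙 (not (p ∨ e))
  from-u true  e     = vanishes
  from-u false true  = vanishes
  from-u false false = trans (∑-firstPrefix F′ v)
    (trans (cong (λ x → 𝟙 (anyProperPrefix F′ v ∨ x)) F[u++b∷v]) (cong 𝟙 (∨-zeroʳ (anyProperPrefix F′ v))))

suffix : ℕ → List A → List A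
suffix j u = drop (length u ∸ j) u

length-suffix : ∀ j (u : List A) → j ≤ length u → length (suffix j u) ≡ j
length-suffix j u j≤ = trans (length-drop (length u ∸ j) u) (m∸[m∸n]≡n j≤)

suffix-++ : ∀ {j} (u t : List A) → length t ≡ j → suffix j (u ++ t) ≡ t
suffix-++ u t refl = trans
  (cong (λ m → drop m (u ++ t)) (trans (cong (_∸ length t) (length-++ u)) (m+n∸n≡m (length u) (length t))))
  (drop-length-++ u)
  where
  drop-length-++ : ∀ u → drop (length u) (u ++ t) ≡ t
  drop-length-++ []      = refl
  drop-length-++ (_ ∷ u) = drop-length-++ u

suffix-suffix : ∀ {j m} (z : List A) → j ≤ m → m ≤ length z → suffix j (suffix m z) ≡ suffix j z
suffix-suffix {j = j} {m} z j≤m m≤z = begin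
  drop (length (drop (length z ∸ m) z) ∸ j) (drop (length z ∸ m) z)
    ≡⟨ cong (λ n → drop (n ∸ j) (drop (length z ∸ m) z)) (length-suffix m z m≤z) ⟩
  drop (m ∸ j) (drop (length z ∸ m) z)
    ≡⟨ drop-drop (length z ∸ m) (m ∸ j) z ⟩
  drop (length z ∸ m + (m ∸ j)) z
    ≡⟨ cong (λ n → drop n z) (sym (trans (cong (_∸ j) (sym (m∸n+n≡m m≤z))) (+-∸-assoc (length z ∸ m) j≤m))) ⟩
  drop (length z ∸ j) z ∎
  where open ≡-Reasoning

suffix-act : ∀ {q} j (h : Permutation′ q) u → suffix j (act h u) ≡ act h (suffix j u)
suffix-act j h u = trans (cong (λ n → drop (n ∸ j) (act h u)) (length-act h u)) (drop-map (length u ∸ j) u)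

take-replicate : ∀ {j m} (x : A) → j ≤ m → take j (replicate m x) ≡ replicate j x
take-replicate x z≤n       = refl
take-replicate x (s≤s j≤m) = cong (x ∷_) (take-replicate x j≤m)

suffix-replicate : ∀ {j m} (x : A) → j ≤ m → suffix j (replicate m x) ≡ replicate j x
suffix-replicate {j = j} {m} x j≤m = begin
  drop (length (replicate m x) ∸ j) (replicate m x) ≡⟨ cong (λ n → drop (n ∸ j) (replicate m x)) (length-replicate m) ⟩
  drop (m ∸ j) (replicate m x)                      ≡⟨ cong (λ n → drop (m ∸ j) (replicate n x)) (sym (m∸n+n≡m j≤m)) ⟩
  drop (m ∸ j) (replicate (m ∸ j + j) x)            ≡⟨ drop-replicate (m ∸ j) ⟩
  replicate j x                                     ∎
  where
  open ≡-Reasoning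
  drop-replicate : ∀ d → drop d (replicate (d + j) x) ≡ replicate j x
  drop-replicate zero    = refl
  drop-replicate (suc d) = drop-replicate d

-- A fixed nonempty pattern a ∷ w′

module Pattern {q : ℕ} (G : FiniteSubgroup q) (a : Fin q) (w′ : Word q) where

  open WordSums q
  open Counting G

  w : Word q
  w = a ∷ w′

  ℓ : ℕ
  ℓ = length w

  ends : Word q → Bool
  ends = endsInPattern G w

  hits : Word q → Bool
  hits = firstPrefix ends

  avoids : Word q → Bool
  avoids = not ∘ anyPrefix ends

  -- #avoiding n = q ^ n · P(T > n) and #hitting n = q ^ n · P(T = n), the numerator of probT G w n.
  #avoiding : ℕ → ℕ
  #avoiding n = ∑ʷ n (𝟙 ∘ avoids)

  #hitting : ℕ → ℕ
  #hitting n = length (filterᵇ (firstHit G w) (words q n))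

  correlation : ℕ → ℕ
  correlation j = #⟦ take j w ↦ suffix j w ⟧

  -- |G| · E[T], by Conway's formula.
  waitNumerator : ℕ
  waitNumerator = ∑[ k ← upTo ℓ ] correlation (suc k) * q ^ suc k

  firstHit≡hits : ∀ u → firstHit G w u ≡ hits u
  firstHit≡hits u = cong (λ b → ends u ∧ not b) (any-take≡anyProperPrefix ends u)

  #hitting≡∑ : ∀ n → #hitting n ≡ ∑ʷ n (𝟙 ∘ hits)
  #hitting≡∑ n = trans (length-filter≡∑ (T? ∘ firstHit G w) (words q n)) (∑-cong (words q n) (cong 𝟙 ∘ firstHit≡hits))

  ends⇒orbit : ∀ z → T (ends z) → ℓ ≤ length z × ∃ λ h → h ∈ elems G × act h w ≡ suffix ℓ z
  ends⇒orbit z e with ℓ≤z , orbit ← Equivalence.to T-∧ e with h , h∈ , T[hw=z] ← find (any⁻ _ (elems G) orbit) =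
    ≤ᵇ⇒≤ ℓ (length z) ℓ≤z , h , h∈ , T-does (≡-dec _≟_ (act h w) (suffix ℓ z)) T[hw=z]

  ends-short : ∀ z → length z < ℓ → ends z ≡ false
  ends-short z z<ℓ with ends z in e
  ... | false = refl
  ... | true  = ⊥-elim (<⇒≱ z<ℓ (proj₁ (ends⇒orbit z (subst T (sym e) _))))

  ends-++-act : ∀ u {g} → g ∈ elems G → T (ends (u ++ act g w))
  ends-++-act u {g} g∈ = Equivalence.from T-∧ (≤⇒≤ᵇ ℓ≤ , subst (T ∘ inOrbit G w) (sym suffix≡) orbit)
    where
    |gw| : length (act g w) ≡ ℓ
    |gw| = length-act g w
    ℓ≤ : ℓ ≤ length (u ++ act g w)
    ℓ≤ = subst (ℓ ≤_) (sym (length-++ u)) (subst (_≤ length u + length (act g w)) |gw| (m≤n+m _ (length u)))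
    suffix≡ : suffix ℓ (u ++ act g w) ≡ act g w
    suffix≡ = suffix-++ u (act g w) |gw|
    orbit : T (inOrbit G w (act g w))
    orbit = any⁺ _ (Any.map (λ { refl → does-T (≡-dec _≟_ (act g w) (act g w)) refl }) g∈)

  ends-++ : ∀ u → T (ends (u ++ w))
  ends-++ u with k , k∈ , k≈id ← find (has-id G) =
    subst (λ v → T (ends (u ++ v))) (trans (act-cong {g = k} {h = id} k≈id w) (act-id w)) (ends-++-act u k∈)

  avoid-step : ∀ n → #avoiding (suc n) + #hitting (suc n) ≡ q * #avoiding n
  avoid-step n = begin
    #avoiding (suc n) + #hitting (suc n)
      ≡⟨ cong (#avoiding (suc n) +_) (#hitting≡∑ (suc n)) ⟩
    ∑ʷ (suc n) (𝟙 ∘ avoids) + ∑ʷ (suc n) (𝟙 ∘ hits)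
      ≡⟨ sym (∑-+ (words q (suc n)) (𝟙 ∘ avoids) (𝟙 ∘ hits)) ⟩
    ∑ʷ (1 + n) (λ z → 𝟙 (avoids z) + 𝟙 (hits z))
      ≡⟨ cong (λ m → ∑ʷ m (λ z → 𝟙 (avoids z) + 𝟙 (hits z))) (+-comm 1 n) ⟩
    ∑ʷ (n + 1) (λ z → 𝟙 (avoids z) + 𝟙 (hits z))
      ≡⟨ ∑ʷ-++ n 1 _ ⟩
    ∑ʷ n (λ u → ∑ʷ 1 (λ v → 𝟙 (avoids (u ++ v)) + 𝟙 (hits (u ++ v))))
      ≡⟨ ∑ʷ-cong n (λ u _ → trans (∑ʷ-cong 1 (λ { (b ∷ []) _ → ¬anyPrefix-∷ʳ ends u b })) (∑ʷ-const 1 _)) ⟩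
    ∑ʷ n (λ u → 𝟙 (avoids u) * q ^ 1)
      ≡⟨ ∑-cong (words q n) (λ u → *-comm (𝟙 (avoids u)) (q ^ 1)) ⟩
    ∑ʷ n (λ u → q ^ 1 * 𝟙 (avoids u))
      ≡⟨ ∑-*ˡ (q ^ 1) (words q n) (𝟙 ∘ avoids) ⟩
    q ^ 1 * #avoiding n
      ≡⟨ cong (_* #avoiding n) (*-identityʳ q) ⟩
    q * #avoiding n ∎
    where open ≡-Reasoning

  ∑-hits-++-act : ∀ u {g} → g ∈ elems G →
    ∑[ k ← upTo ℓ ] 𝟙 (hits (u ++ act g (take (suc k) w))) ≡ 𝟙 (avoids u)
  ∑-hits-++-act u {g} g∈ = begin
    ∑[ k ← upTo ℓ ] 𝟙 (hits (u ++ act g (take (suc k) w)))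
      ≡⟨ ∑-cong (upTo ℓ) (λ k → cong (λ t → 𝟙 (hits (u ++ t))) (sym (take-map (suc k) w))) ⟩
    ∑[ k ← upTo ℓ ] 𝟙 (hits (u ++ take (suc k) (act g w)))
      ≡⟨ cong (λ n → ∑[ k ← upTo (suc n) ] 𝟙 (hits (u ++ take (suc k) (act g w)))) (sym (length-act g w′)) ⟩
    ∑[ k ← upTo (suc (length (act g w′))) ] 𝟙 (hits (u ++ take (suc k) (act g w)))
      ≡⟨ ∑-firstPrefix-++ ends u (g ⟨$⟩ʳ a) (act g w′) (Equivalence.to T-≡ (ends-++-act u g∈)) ⟩
    𝟙 (avoids u) ∎
    where open ≡-Reasoning

  avoiding-by-hits : ∀ n {g} → g ∈ elems G →
    #avoiding n ≡ ∑[ k ← upTo ℓ ] ∑ʷ (n + suc k) (λ z → 𝟙 (hits z) * 𝟙 (act g (take (suc k) w) =ʷ suffix (suc k) z))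
  avoiding-by-hits n {g} g∈ = sym (begin
    ∑[ k ← upTo ℓ ] ∑ʷ (n + suc k) (λ z → 𝟙 (hits z) * 𝟙 (p k =ʷ suffix (suc k) z))
      ≡⟨ ∑-cong-∈ (upTo ℓ) (λ k k∈ → trans (∑ʷ-++ n (suc k) _) (∑ʷ-cong n (λ u _ → hit-at u k (∈-upTo⁻ k∈)))) ⟩
    ∑[ k ← upTo ℓ ] ∑ʷ n (λ u → 𝟙 (hits (u ++ p k)))
      ≡⟨ sym (∑-swap (words q n) (upTo ℓ) (λ u k → 𝟙 (hits (u ++ p k)))) ⟩
    ∑ʷ n (λ u → ∑[ k ← upTo ℓ ] 𝟙 (hits (u ++ p k)))
      ≡⟨ ∑-cong (words q n) (λ u → ∑-hits-++-act u g∈) ⟩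
    #avoiding n ∎)
    where
    open ≡-Reasoning
    p : ℕ → Word q
    p k = act g (take (suc k) w)

    |p| : ∀ k → k < ℓ → length (p k) ≡ suc k
    |p| k k<ℓ = trans (length-act g (take (suc k) w)) (trans (length-take (suc k) w) (m≤n⇒m⊓n≡m k<ℓ))

    hit-at : ∀ u k → k < ℓ →
      ∑ʷ (suc k) (λ t → 𝟙 (hits (u ++ t)) * 𝟙 (p k =ʷ suffix (suc k) (u ++ t))) ≡ 𝟙 (hits (u ++ p k))
    hit-at u k k<ℓ = trans (∑ʷ-point (suc k) (p k) _ (|p| k k<ℓ) off)
      (trans (cong (λ t → 𝟙 (hits (u ++ p k)) * 𝟙 (p k =ʷ t)) (suffix-++ u (p k) (|p| k k<ℓ)))
        (trans (cong (λ b → 𝟙 (hits (u ++ p k)) * 𝟙 b) (dec-true (≡-dec _≟_ (p k) (p k)) refl))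
          (*-identityʳ _)))
      where
      off : ∀ t → length t ≡ suc k → t ≢ p k → 𝟙 (hits (u ++ t)) * 𝟙 (p k =ʷ suffix (suc k) (u ++ t)) ≡ 0
      off t |t| t≢pk = trans (cong (λ s → 𝟙 (hits (u ++ t)) * 𝟙 (p k =ʷ s)) (suffix-++ u t |t|))
        (trans (cong (λ b → 𝟙 (hits (u ++ t)) * 𝟙 b) (dec-false (≡-dec _≟_ (p k) t) (t≢pk ∘ sym)))
          (*-zeroʳ (𝟙 (hits (u ++ t)))))

  suffix-correlation : ∀ z j → T (ends z) → j ≤ ℓ → #⟦ take j w ↦ suffix j z ⟧ ≡ correlation j
  suffix-correlation z j e j≤ℓ with ℓ≤z , h , h∈ , hw≡ ← ends⇒orbit z e = begin
    #⟦ take j w ↦ suffix j z ⟧              ≡⟨ cong #⟦ take j w ↦_⟧ (sym (suffix-suffix z j≤ℓ ℓ≤z)) ⟩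
    #⟦ take j w ↦ suffix j (suffix ℓ z) ⟧   ≡⟨ cong (λ v → #⟦ take j w ↦ suffix j v ⟧) (sym hw≡) ⟩
    #⟦ take j w ↦ suffix j (act h w) ⟧      ≡⟨ cong #⟦ take j w ↦_⟧ (suffix-act j h w) ⟩
    #⟦ take j w ↦ act h (suffix j w) ⟧      ≡⟨ ↦-translate h∈ (take j w) (suffix j w) ⟩
    correlation j                            ∎
    where open ≡-Reasoning

  -- Summing avoiding-by-hits over G weighs a hit z by the number of g matching its suffix, which is
  -- a correlation because z ends in a G-translate of w.
  conway : ∀ n → order G * #avoiding n ≡ ∑[ k ← upTo ℓ ] correlation (suc k) * #hitting (n + suc k)
  conway n = begin
    order G * #avoiding n
      ≡⟨ trans (*-comm (order G) (#avoiding n)) (sym (∑-const (#avoiding n) S)) ⟩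
    ∑[ g ← S ] #avoiding n
      ≡⟨ ∑-cong-∈ S (λ g g∈ → avoiding-by-hits n g∈) ⟩
    ∑[ g ← S ] ∑[ k ← upTo ℓ ] ∑ʷ (n + suc k) (H g k)
      ≡⟨ ∑-swap S (upTo ℓ) (λ g k → ∑ʷ (n + suc k) (H g k)) ⟩
    ∑[ k ← upTo ℓ ] ∑[ g ← S ] ∑ʷ (n + suc k) (H g k)
      ≡⟨ ∑-cong-∈ (upTo ℓ) (λ k k∈ → trans (∑-swap S (words q (n + suc k)) (λ g → H g k))
                                           (∑-cong (words q (n + suc k)) (hit-weight k (∈-upTo⁻ k∈)))) ⟩
    ∑[ k ← upTo ℓ ] ∑ʷ (n + suc k) (λ z → correlation (suc k) * 𝟙 (hits z))
      ≡⟨ ∑-cong (upTo ℓ) (λ k → trans (∑-*ˡ (correlation (suc k)) (words q (n + suc k)) (𝟙 ∘ hits))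
                                       (cong (correlation (suc k) *_) (sym (#hitting≡∑ (n + suc k))))) ⟩
    ∑[ k ← upTo ℓ ] correlation (suc k) * #hitting (n + suc k) ∎
    where
    open ≡-Reasoning
    S = elems G

    H : Permutation′ q → ℕ → Word q → ℕ
    H g k z = 𝟙 (hits z) * 𝟙 (act g (take (suc k) w) =ʷ suffix (suc k) z)

    hit-weight : ∀ k → k < ℓ → ∀ z → ∑[ g ← S ] H g k z ≡ correlation (suc k) * 𝟙 (hits z)
    hit-weight k k<ℓ z with hits z in hit
    ... | false = trans (∑-zero S) (sym (*-zeroʳ (correlation (suc k))))
    ... | true  = trans (∑-cong S (λ g → +-identityʳ _))
      (trans (suffix-correlation z (suc k) (proj₁ (Equivalence.to T-∧ (subst T (sym hit) _))) k<ℓ)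
             (sym (*-identityʳ _)))

  #hitting-early : ∀ n → n < ℓ → #hitting n ≡ 0
  #hitting-early n n<ℓ = trans (#hitting≡∑ n) (trans (∑ʷ-cong n too-short) (∑-zero (words q n)))
    where
    too-short : ∀ z → length z ≡ n → 𝟙 (hits z) ≡ 0
    too-short z |z| = cong (λ b → 𝟙 (b ∧ not (anyProperPrefix ends z))) (ends-short z (subst (_< ℓ) (sym |z|) n<ℓ))

  #avoiding-zero : #avoiding 0 ≡ 1
  #avoiding-zero = cong (λ b → 𝟙 (not b) + 0) (ends-short [] (s≤s z≤n))

  avoids-++ : ∀ u t → length t ≡ ℓ → anyPrefix ends (u ++ t) ≡ false → anyPrefix ends u ≡ false × t ≢ w
  avoids-++ u (b ∷ t) _ u++t-avoids = cong₂ _∨_ (∨-conicalˡ _ _ before-t) ¬ends-u , t≢w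
    where
    before-t : anyProperPrefix ends u ∨ (ends (u ++ []) ∨ anyProperPrefix (λ z → ends (u ++ b ∷ z)) t) ≡ false
    before-t = trans (sym (anyProperPrefix-++ ends u (b ∷ t))) (∨-conicalˡ _ _ u++t-avoids)
    ¬ends-u : ends u ≡ false
    ¬ends-u = trans (cong ends (sym (++-identityʳ u))) (∨-conicalˡ _ _ (∨-conicalʳ (anyProperPrefix ends u) _ before-t))
    t≢w : b ∷ t ≢ w
    t≢w refl = subst T (∨-conicalʳ _ _ u++t-avoids) (ends-++ u)

  avoids-++-≤ : ∀ u t → length t ≡ ℓ → 𝟙 (avoids (u ++ t)) ≤ 𝟙 (avoids u) * 𝟙 (not (t =ʷ w))
  avoids-++-≤ u t |t| with anyPrefix ends (u ++ t) in u++t-avoids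
  ... | true  = z≤n
  ... | false with u-avoids , t≢w ← avoids-++ u t |t| u++t-avoids
    rewrite u-avoids | dec-false (≡-dec _≟_ t w) t≢w = ≤-refl

  #words≢w : ∑ʷ ℓ (λ t → 𝟙 (not (t =ʷ w))) + 1 ≡ q ^ ℓ
  #words≢w = begin
    ∑ʷ ℓ (λ t → 𝟙 (not (t =ʷ w))) + 1
      ≡⟨ cong (∑ʷ ℓ (λ t → 𝟙 (not (t =ʷ w))) +_) (sym only-w) ⟩
    ∑ʷ ℓ (λ t → 𝟙 (not (t =ʷ w))) + ∑ʷ ℓ (λ t → 𝟙 (t =ʷ w))
      ≡⟨ sym (∑-+ (words q ℓ) _ _) ⟩
    ∑ʷ ℓ (λ t → 𝟙 (not (t =ʷ w)) + 𝟙 (t =ʷ w))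
      ≡⟨ ∑-cong (words q ℓ) (λ t → complement (t =ʷ w)) ⟩
    ∑ʷ ℓ (λ _ → 1)
      ≡⟨ trans (∑ʷ-const ℓ 1) (*-identityˡ _) ⟩
    q ^ ℓ ∎
    where
    open ≡-Reasoning
    complement : ∀ b → 𝟙 (not b) + 𝟙 b ≡ 1
    complement true  = refl
    complement false = refl
    only-w : ∑ʷ ℓ (λ t → 𝟙 (t =ʷ w)) ≡ 1
    only-w = trans (∑ʷ-point ℓ w _ refl (λ t _ t≢w → cong 𝟙 (dec-false (≡-dec _≟_ t w) t≢w)))
                   (cong 𝟙 (dec-true (≡-dec _≟_ w w) refl))

  avoiding-decay : ∀ n → #avoiding (n + ℓ) + #avoiding n ≤ q ^ ℓ * #avoiding n
  avoiding-decay n = begin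
    #avoiding (n + ℓ) + #avoiding n
      ≡⟨ cong (_+ #avoiding n) (∑ʷ-++ n ℓ (𝟙 ∘ avoids)) ⟩
    ∑ʷ n (λ u → ∑ʷ ℓ (λ t → 𝟙 (avoids (u ++ t)))) + #avoiding n
      ≡⟨ sym (∑-+ (words q n) _ _) ⟩
    ∑ʷ n (λ u → ∑ʷ ℓ (λ t → 𝟙 (avoids (u ++ t))) + 𝟙 (avoids u))
      ≤⟨ ∑-mono (words q n) extensions ⟩
    ∑ʷ n (λ u → q ^ ℓ * 𝟙 (avoids u))
      ≡⟨ ∑-*ˡ (q ^ ℓ) (words q n) (𝟙 ∘ avoids) ⟩
    q ^ ℓ * #avoiding n ∎
    where
    open ≤-Reasoning
    extensions : ∀ u → ∑ʷ ℓ (λ t → 𝟙 (avoids (u ++ t))) + 𝟙 (avoids u) ≤ q ^ ℓ * 𝟙 (avoids u)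
    extensions u = begin
      ∑ʷ ℓ (λ t → 𝟙 (avoids (u ++ t))) + 𝟙 (avoids u)
        ≤⟨ +-monoˡ-≤ (𝟙 (avoids u)) (∑ʷ-mono ℓ (avoids-++-≤ u)) ⟩
      ∑ʷ ℓ (λ t → 𝟙 (avoids u) * 𝟙 (not (t =ʷ w))) + 𝟙 (avoids u)
        ≡⟨ cong₂ _+_ (∑-*ˡ (𝟙 (avoids u)) (words q ℓ) _) (sym (*-identityʳ (𝟙 (avoids u)))) ⟩
      𝟙 (avoids u) * ∑ʷ ℓ (λ t → 𝟙 (not (t =ʷ w))) + 𝟙 (avoids u) * 1
        ≡⟨ sym (*-distribˡ-+ (𝟙 (avoids u)) _ 1) ⟩
      𝟙 (avoids u) * (∑ʷ ℓ (λ t → 𝟙 (not (t =ʷ w))) + 1)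
        ≡⟨ trans (cong (𝟙 (avoids u) *_) #words≢w) (*-comm (𝟙 (avoids u)) (q ^ ℓ)) ⟩
      q ^ ℓ * 𝟙 (avoids u) ∎

  correlation-≤ : ∀ {x} → (∀ y → stabOrder G y ≤ stabOrder G x) → ∀ j → 0 < j → j ≤ ℓ →
    correlation j ≤ stabOrder G x
  correlation-≤ x-max (suc j) _ j<ℓ = ≤-trans
    (↦-head-≤ a (take j w′) (suffix (suc j) w) (subst (0 <_) (sym (length-suffix (suc j) w j<ℓ)) z<s)) (x-max a)

correlation-replicate : ∀ {q} (G : FiniteSubgroup q) x n j → 0 < j → j ≤ suc n →
  Pattern.correlation G x (replicate n x) j ≡ stabOrder G x
correlation-replicate G x n (suc j) _ j<ℓ = begin
  #⟦ take (suc j) (replicate (suc n) x) ↦ suffix (suc j) (replicate (suc n) x) ⟧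
    ≡⟨ cong₂ #⟦_↦_⟧ (take-replicate x j<ℓ) (suffix-replicate x j<ℓ) ⟩
  #⟦ replicate (suc j) x ↦ replicate (suc j) x ⟧
    ≡⟨ ↦-replicate j x ⟩
  stabOrder G x ∎
  where
  open ≡-Reasoning
  open Counting G

-- Rational arithmetic

infixl 7 _÷_

_÷_ : ℕ → (d : ℕ) .{{_ : NonZero d}} → ℚ
a ÷ d = ℤ.+ a / d

toℚᵘ-÷ : ∀ a b .{{_ : NonZero b}} → toℚᵘ (a ÷ b) ℚᵘ.≃ ℚᵘ.mkℚᵘ (ℤ.+ a) (pred b)
toℚᵘ-÷ a (suc b) = ℚ.toℚᵘ-fromℚᵘ (ℚᵘ.mkℚᵘ (ℤ.+ a) b)

÷-≤ : ∀ a b c d .{{_ : NonZero b}} .{{_ : NonZero d}} → a * d ≤ c * b → a ÷ b ℚ.≤ c ÷ d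
÷-≤ a b@(suc _) c d@(suc _) h = ℚ.toℚᵘ-cancel-≤
  (ℚᵘ.≤-respˡ-≃ (ℚᵘ.≃-sym (toℚᵘ-÷ a b)) (ℚᵘ.≤-respʳ-≃ (ℚᵘ.≃-sym (toℚᵘ-÷ c d))
    (ℚᵘ.*≤* (subst₂ ℤ._≤_ (ℤ.pos-* a d) (ℤ.pos-* c b) (ℤ.+≤+ h)))))

÷-< : ∀ a b c d .{{_ : NonZero b}} .{{_ : NonZero d}} → a * d < c * b → a ÷ b ℚ.< c ÷ d
÷-< a b@(suc _) c d@(suc _) h = ℚ.toℚᵘ-cancel-<
  (ℚᵘ.<-respˡ-≃ (ℚᵘ.≃-sym (toℚᵘ-÷ a b)) (ℚᵘ.<-respʳ-≃ (ℚᵘ.≃-sym (toℚᵘ-÷ c d))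
    (ℚᵘ.*<* (subst₂ ℤ._<_ (ℤ.pos-* a d) (ℤ.pos-* c b) (ℤ.+<+ h)))))

÷-≡ : ∀ a b c d .{{_ : NonZero b}} .{{_ : NonZero d}} → a * d ≡ c * b → a ÷ b ≡ c ÷ d
÷-≡ a b c d h = ℚ.≤-antisym (÷-≤ a b c d (≤-reflexive h)) (÷-≤ c d a b (≤-reflexive (sym h)))

÷-+ : ∀ a b c d .{{_ : NonZero b}} .{{_ : NonZero d}} →
  a ÷ b ℚ.+ c ÷ d ≡ ((a * d + c * b) ÷ (b * d)) {{m*n≢0 b d}}
÷-+ a b@(suc _) c d@(suc _) = ℚ.toℚᵘ-injective (ℚᵘ.≃-trans (ℚ.toℚᵘ-homo-+ (a ÷ b) (c ÷ d))
  (ℚᵘ.≃-trans (ℚᵘ.+-cong (toℚᵘ-÷ a b) (toℚᵘ-÷ c d))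
    (ℚᵘ.≃-trans (ℚᵘ.≃-reflexive numerators) (ℚᵘ.≃-sym (toℚᵘ-÷ (a * d + c * b) (b * d))))))
  where
  numerators : ℚᵘ.mkℚᵘ (ℤ.+ a) (pred b) ℚᵘ.+ ℚᵘ.mkℚᵘ (ℤ.+ c) (pred d) ≡ ℚᵘ.mkℚᵘ (ℤ.+ (a * d + c * b)) (pred (b * d))
  numerators = cong (λ n → ℚᵘ.mkℚᵘ n (pred (b * d)))
    (trans (cong₂ ℤ._+_ (sym (ℤ.pos-* a d)) (sym (ℤ.pos-* c b))) (sym (ℤ.pos-+ (a * d) (c * b))))

÷-* : ∀ a b c d .{{_ : NonZero b}} .{{_ : NonZero d}} → (a ÷ b) ℚ.* (c ÷ d) ≡ ((a * c) ÷ (b * d)) {{m*n≢0 b d}}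
÷-* a b@(suc _) c d@(suc _) = ℚ.toℚᵘ-injective (ℚᵘ.≃-trans (ℚ.toℚᵘ-homo-* (a ÷ b) (c ÷ d))
  (ℚᵘ.≃-trans (ℚᵘ.*-cong (toℚᵘ-÷ a b) (toℚᵘ-÷ c d))
    (ℚᵘ.≃-trans (ℚᵘ.≃-reflexive numerators) (ℚᵘ.≃-sym (toℚᵘ-÷ (a * c) (b * d))))))
  where
  numerators : ℚᵘ.mkℚᵘ (ℤ.+ a) (pred b) ℚᵘ.* ℚᵘ.mkℚᵘ (ℤ.+ c) (pred d) ≡ ℚᵘ.mkℚᵘ (ℤ.+ (a * c)) (pred (b * d))
  numerators = cong (λ n → ℚᵘ.mkℚᵘ n (pred (b * d))) (sym (ℤ.pos-* a c))

÷-+-same : ∀ a c D .{{_ : NonZero D}} → a ÷ D ℚ.+ c ÷ D ≡ (a + c) ÷ D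
÷-+-same a c D = trans (÷-+ a D c D) (÷-≡ (a * D + c * D) (D * D) (a + c) D {{m*n≢0 D D}}
  (trans (cong (_* D) (sym (*-distribʳ-+ D a c))) (*-assoc (a + c) D D)))

∣s-r∣<ε : ∀ {s r e ε} → s ℚ.≤ r → r ℚ.≤ s ℚ.+ e → e ℚ.< ε → ∣ s ℚ.- r ∣ ℚ.< ε
∣s-r∣<ε {s} {r} {e} {ε} s≤r r≤s+e e<ε = subst (ℚ._< ε) (sym ∣s-r∣≡r-s) (ℚ.≤-<-trans r-s≤e e<ε)
  where
  open ℚ-Solver
  ∣s-r∣≡r-s : ∣ s ℚ.- r ∣ ≡ r ℚ.- s
  ∣s-r∣≡r-s = trans (sym (ℚ.∣-p∣≡∣p∣ (s ℚ.- r)))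
    (trans (cong ∣_∣ (solve 2 (λ s r → :- (s :- r) := r :- s) refl s r))
      (ℚ.0≤p⇒∣p∣≡p (subst (ℚ._≤ r ℚ.- s) (ℚ.+-inverseʳ s) (ℚ.+-monoˡ-≤ (ℚ.- s) s≤r))))
  r-s≤e : r ℚ.- s ℚ.≤ e
  r-s≤e = subst (r ℚ.- s ℚ.≤_) (solve 2 (λ s e → (s :+ e) :- s := e) refl s e) (ℚ.+-monoˡ-≤ (ℚ.- s) r≤s+e)

Σℚ-suc : ∀ (h : ℕ → ℚ) m → Σℚ (suc m) h ≡ Σℚ m h ℚ.+ h m
Σℚ-suc h m = trans (cong (foldr step 0ℚ) (sym (upTo-∷ʳ m)))
  (trans (foldr-++ step 0ℚ (upTo m) [ m ])
    (trans (shift (upTo m) (h m ℚ.+ 0ℚ)) (cong (Σℚ m h ℚ.+_) (ℚ.+-identityʳ (h m)))))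
  where
  step : ℕ → ℚ → ℚ
  step n acc = h n ℚ.+ acc
  shift : ∀ xs c → foldr step c xs ≡ foldr step 0ℚ xs ℚ.+ c
  shift []       c = sym (ℚ.+-identityˡ c)
  shift (x ∷ xs) c = trans (cong (h x ℚ.+_) (shift xs c)) (sym (ℚ.+-assoc (h x) _ c))

positive-fraction : ∀ {ε} → 0ℚ ℚ.< ε → ∃ λ p → ∃ λ d → ε ≡ suc p ÷ suc d
positive-fraction {mkℚ +[1+ p ] d c} _ = p , d , sym (ℚ.↥p/↧p≡p (mkℚ +[1+ p ] d c))
positive-fraction {mkℚ (ℤ.+ 0)  d c} (ℚ.*<* (ℤ.+<+ ()))
positive-fraction {mkℚ -[1+ p ] d c} (ℚ.*<* ())

-- Convergence of the waiting-time series

P^t*[P+t]≤P*[P+1]^t : ∀ P t → P ^ t * (P + t) ≤ P * (P + 1) ^ t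
P^t*[P+t]≤P*[P+1]^t P zero    = ≤-reflexive (trans (*-identityˡ (P + 0)) (trans (+-identityʳ P) (sym (*-identityʳ P))))
P^t*[P+t]≤P*[P+1]^t P (suc t) = begin
  P * P ^ t * (P + suc t)
    ≡⟨ solve 3 (λ p a t → p :* a :* (p :+ (con 1 :+ t)) := p :* (a :* (p :+ t)) :+ p :* a) refl P (P ^ t) t ⟩
  P * (P ^ t * (P + t)) + P * P ^ t
    ≤⟨ +-mono-≤ (*-monoʳ-≤ P (P^t*[P+t]≤P*[P+1]^t P t)) (*-monoʳ-≤ P (^-monoˡ-≤ t (m≤m+n P 1))) ⟩
  P * (P * (P + 1) ^ t) + P * (P + 1) ^ t
    ≡⟨ solve 2 (λ p b → p :* (p :* b) :+ p :* b := p :* ((p :+ con 1) :* b)) refl P ((P + 1) ^ t) ⟩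
  P * (P + 1) ^ suc t ∎
  where
  open ≤-Reasoning
  open +-*-Solver

module WaitingTime (q : ℕ) .{{_ : NonZero q}} (q≥2 : 2 ≤ q) (ℓ′ : ℕ) (avoid hit corr : ℕ → ℕ)
  (|G| : ℕ) .{{_ : NonZero |G|}}
  (avoid-step  : ∀ n → avoid (suc n) + hit (suc n) ≡ q * avoid n)
  (avoid-zero  : avoid 0 ≡ 1)
  (hit-early   : ∀ n → n < suc ℓ′ → hit n ≡ 0)
  (conway      : ∀ n → |G| * avoid n ≡ ∑[ k ← upTo (suc ℓ′) ] corr (suc k) * hit (n + suc k))
  (avoid-decay : ∀ n → avoid (n + suc ℓ′) + avoid n ≤ q ^ suc ℓ′ * avoid n) where

  open +-*-Solver

  ℓ : ℕ
  ℓ = suc ℓ′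

  -- With D = q ^ m: mass m / D = Σ_{n<m} hit n / q ^ n, moment m / D = Σ_{n<m} n · hit n / q ^ n,
  -- avoidMass m / D = Σ_{n<m} avoid n / q ^ n and shiftedMass k m / D = Σ_{n<m} hit (n + k + 1) / q ^ n.
  mass : ℕ → ℕ
  mass zero    = 0
  mass (suc m) = q * (mass m + hit m)

  moment : ℕ → ℕ
  moment zero    = 0
  moment (suc m) = q * (moment m + m * hit m)

  avoidMass : ℕ → ℕ
  avoidMass zero    = 0
  avoidMass (suc m) = q * (avoidMass m + avoid m)

  shiftedMass : ℕ → ℕ → ℕ
  shiftedMass k zero    = 0
  shiftedMass k (suc m) = q * (shiftedMass k m + hit (m + suc k))

  waitNumerator : ℕ
  waitNumerator = ∑[ k ← upTo ℓ ] corr (suc k) * q ^ suc k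

  overshoot : ℕ → ℕ
  overshoot m = ∑[ k ← upTo ℓ ] corr (suc k) * avoid (m + k)

  mass-complement : ∀ m → mass (suc m) + q * avoid m ≡ q ^ suc m
  mass-complement zero rewrite avoid-zero | hit-early 0 z<s =
    solve 1 (λ q → q :* (con 0 :+ con 0) :+ q :* con 1 := q :* con 1) refl q
  mass-complement (suc m) = begin
    q * (mass (suc m) + hit (suc m)) + q * avoid (suc m)
      ≡⟨ solve 4 (λ q y g f → q :* (y :+ g) :+ q :* f := q :* (y :+ (f :+ g)))
                 refl q (mass (suc m)) (hit (suc m)) (avoid (suc m)) ⟩
    q * (mass (suc m) + (avoid (suc m) + hit (suc m)))
      ≡⟨ cong (λ z → q * (mass (suc m) + z)) (avoid-step m) ⟩
    q * (mass (suc m) + q * avoid m)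
      ≡⟨ cong (q *_) (mass-complement m) ⟩
    q ^ suc (suc m) ∎
    where open ≡-Reasoning

  moment-complement : ∀ m → moment (suc m) + q * (m * avoid m) ≡ q * avoidMass m
  moment-complement zero    =
    solve 2 (λ q g → q :* (con 0 :+ con 0 :* g) :+ q :* (con 0 :* con 0) := q :* con 0) refl q (hit 0)
  moment-complement (suc m) = begin
    q * (moment (suc m) + suc m * hit (suc m)) + q * (suc m * avoid (suc m))
      ≡⟨ solve 5 (λ q z m g f → q :* (z :+ (con 1 :+ m) :* g) :+ q :* ((con 1 :+ m) :* f) := q :* (z :+ (con 1 :+ m) :* (f :+ g)))
               refl q (moment (suc m)) m (hit (suc m)) (avoid (suc m)) ⟩
    q * (moment (suc m) + suc m * (avoid (suc m) + hit (suc m)))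
      ≡⟨ cong (λ z → q * (moment (suc m) + suc m * z)) (avoid-step m) ⟩
    q * (moment (suc m) + suc m * (q * avoid m))
      ≡⟨ solve 4 (λ q z m f → q :* (z :+ (con 1 :+ m) :* (q :* f)) := q :* ((z :+ q :* (m :* f)) :+ q :* f))
                 refl q (moment (suc m)) m (avoid m) ⟩
    q * ((moment (suc m) + q * (m * avoid m)) + q * avoid m)
      ≡⟨ cong (λ z → q * (z + q * avoid m)) (moment-complement m) ⟩
    q * (q * avoidMass m + q * avoid m)
      ≡⟨ cong (q *_) (sym (*-distribˡ-+ q (avoidMass m) (avoid m))) ⟩
    q * avoidMass (suc m) ∎
    where open ≡-Reasoning

  avoid-early : ∀ k → k < ℓ → avoid k ≡ q ^ k
  avoid-early zero    _         = avoid-zero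
  avoid-early (suc k) (s≤s k<ℓ) = begin
    avoid (suc k)                  ≡⟨ sym (+-identityʳ _) ⟩
    avoid (suc k) + 0              ≡⟨ cong (avoid (suc k) +_) (sym (hit-early (suc k) (s≤s k<ℓ))) ⟩
    avoid (suc k) + hit (suc k)    ≡⟨ avoid-step k ⟩
    q * avoid k                    ≡⟨ cong (q *_) (avoid-early k (m≤n⇒m≤1+n k<ℓ)) ⟩
    q ^ suc k                      ∎
    where open ≡-Reasoning

  shiftedMass-complement : ∀ k → k < ℓ → ∀ m → shiftedMass k m + q * avoid (m + k) ≡ q ^ (m + suc k)
  shiftedMass-complement k k<ℓ zero    = cong (q *_) (avoid-early k k<ℓ)
  shiftedMass-complement k k<ℓ (suc m) = begin
    q * (shiftedMass k m + hit (m + suc k)) + q * avoid (suc (m + k))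
      ≡⟨ cong (λ z → q * (shiftedMass k m + hit z) + q * avoid (suc (m + k))) (+-suc m k) ⟩
    q * (shiftedMass k m + hit (suc (m + k))) + q * avoid (suc (m + k))
      ≡⟨ solve 4 (λ q v g f → q :* (v :+ g) :+ q :* f := q :* (v :+ (f :+ g)))
                 refl q (shiftedMass k m) (hit (suc (m + k))) (avoid (suc (m + k))) ⟩
    q * (shiftedMass k m + (avoid (suc (m + k)) + hit (suc (m + k))))
      ≡⟨ cong (λ z → q * (shiftedMass k m + z)) (avoid-step (m + k)) ⟩
    q * (shiftedMass k m + q * avoid (m + k))
      ≡⟨ cong (q *_) (shiftedMass-complement k k<ℓ m) ⟩
    q ^ (suc m + suc k) ∎
    where open ≡-Reasoning

  conway-avoidMass : ∀ m → |G| * avoidMass m ≡ ∑[ k ← upTo ℓ ] corr (suc k) * shiftedMass k m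
  conway-avoidMass zero    =
    trans (*-zeroʳ |G|) (sym (trans (∑-cong (upTo ℓ) (λ k → *-zeroʳ (corr (suc k)))) (∑-zero (upTo ℓ))))
  conway-avoidMass (suc m) = begin
    |G| * (q * (avoidMass m + avoid m))
      ≡⟨ solve 4 (λ G q x f → G :* (q :* (x :+ f)) := q :* (G :* x :+ G :* f)) refl |G| q (avoidMass m) (avoid m) ⟩
    q * (|G| * avoidMass m + |G| * avoid m)
      ≡⟨ cong₂ (λ a b → q * (a + b)) (conway-avoidMass m) (conway m) ⟩
    q * ((∑[ k ← upTo ℓ ] corr (suc k) * shiftedMass k m) + (∑[ k ← upTo ℓ ] corr (suc k) * hit (m + suc k)))
      ≡⟨ cong (q *_) (sym (∑-+ (upTo ℓ) (λ k → corr (suc k) * shiftedMass k m) (λ k → corr (suc k) * hit (m + suc k)))) ⟩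
    q * (∑[ k ← upTo ℓ ] (corr (suc k) * shiftedMass k m + corr (suc k) * hit (m + suc k)))
      ≡⟨ sym (∑-*ˡ q (upTo ℓ) _) ⟩
    ∑[ k ← upTo ℓ ] q * (corr (suc k) * shiftedMass k m + corr (suc k) * hit (m + suc k))
      ≡⟨ ∑-cong (upTo ℓ) (λ k → solve 4 (λ q d v g → q :* (d :* v :+ d :* g) := d :* (q :* (v :+ g)))
                                   refl q (corr (suc k)) (shiftedMass k m) (hit (m + suc k))) ⟩
    ∑[ k ← upTo ℓ ] corr (suc k) * shiftedMass k (suc m) ∎
    where open ≡-Reasoning

  conway-complement : ∀ m → |G| * avoidMass m + q * overshoot m ≡ q ^ m * waitNumerator
  conway-complement m = begin
    |G| * avoidMass m + q * overshoot m
      ≡⟨ cong₂ _+_ (conway-avoidMass m) (sym (∑-*ˡ q (upTo ℓ) (λ k → corr (suc k) * avoid (m + k)))) ⟩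
    (∑[ k ← upTo ℓ ] corr (suc k) * shiftedMass k m) + (∑[ k ← upTo ℓ ] q * (corr (suc k) * avoid (m + k)))
      ≡⟨ sym (∑-+ (upTo ℓ) (λ k → corr (suc k) * shiftedMass k m) (λ k → q * (corr (suc k) * avoid (m + k)))) ⟩
    ∑[ k ← upTo ℓ ] (corr (suc k) * shiftedMass k m + q * (corr (suc k) * avoid (m + k)))
      ≡⟨ ∑-cong-∈ (upTo ℓ) (λ k k∈ → per-k k (∈-upTo⁻ k∈)) ⟩
    ∑[ k ← upTo ℓ ] q ^ m * (corr (suc k) * q ^ suc k)
      ≡⟨ ∑-*ˡ (q ^ m) (upTo ℓ) _ ⟩
    q ^ m * waitNumerator ∎
    where
    open ≡-Reasoning
    per-k : ∀ k → k < ℓ →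
      corr (suc k) * shiftedMass k m + q * (corr (suc k) * avoid (m + k)) ≡ q ^ m * (corr (suc k) * q ^ suc k)
    per-k k k<ℓ = begin
      corr (suc k) * shiftedMass k m + q * (corr (suc k) * avoid (m + k))
        ≡⟨ solve 4 (λ d v q f → d :* v :+ q :* (d :* f) := d :* (v :+ q :* f))
                   refl (corr (suc k)) (shiftedMass k m) q (avoid (m + k)) ⟩
      corr (suc k) * (shiftedMass k m + q * avoid (m + k))
        ≡⟨ cong (corr (suc k) *_) (trans (shiftedMass-complement k k<ℓ m) (^-distribˡ-+-* q m (suc k))) ⟩
      corr (suc k) * (q ^ m * q ^ suc k)
        ≡⟨ solve 3 (λ d a b → d :* (a :* b) := a :* (d :* b)) refl (corr (suc k)) (q ^ m) (q ^ suc k) ⟩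
      q ^ m * (corr (suc k) * q ^ suc k) ∎

  avoid-growth : ∀ m k → avoid (m + k) ≤ q ^ k * avoid m
  avoid-growth m zero    = ≤-reflexive (trans (cong avoid (+-identityʳ m)) (sym (*-identityˡ (avoid m))))
  avoid-growth m (suc k) = begin
    avoid (m + suc k)                          ≡⟨ cong avoid (+-suc m k) ⟩
    avoid (suc (m + k))                        ≤⟨ m≤m+n (avoid (suc (m + k))) (hit (suc (m + k))) ⟩
    avoid (suc (m + k)) + hit (suc (m + k))    ≡⟨ avoid-step (m + k) ⟩
    q * avoid (m + k)                          ≤⟨ *-monoʳ-≤ q (avoid-growth m k) ⟩
    q * (q ^ k * avoid m)                      ≡⟨ sym (*-assoc q (q ^ k) (avoid m)) ⟩
    q ^ suc k * avoid m                        ∎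
    where open ≤-Reasoning

  overshoot-≤ : ∀ m → q * overshoot m ≤ waitNumerator * avoid m
  overshoot-≤ m = begin
    q * overshoot m
      ≡⟨ sym (∑-*ˡ q (upTo ℓ) (λ k → corr (suc k) * avoid (m + k))) ⟩
    ∑[ k ← upTo ℓ ] q * (corr (suc k) * avoid (m + k))
      ≤⟨ ∑-mono (upTo ℓ) (λ k → *-monoʳ-≤ q (*-monoʳ-≤ (corr (suc k)) (avoid-growth m k))) ⟩
    ∑[ k ← upTo ℓ ] q * (corr (suc k) * (q ^ k * avoid m))
      ≡⟨ ∑-cong (upTo ℓ) (λ k → solve 4 (λ q d a f → q :* (d :* (a :* f)) := f :* (d :* (q :* a)))
                                   refl q (corr (suc k)) (q ^ k) (avoid m)) ⟩
    ∑[ k ← upTo ℓ ] avoid m * (corr (suc k) * q ^ suc k)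
      ≡⟨ ∑-*ˡ (avoid m) (upTo ℓ) _ ⟩
    avoid m * waitNumerator
      ≡⟨ *-comm (avoid m) waitNumerator ⟩
    waitNumerator * avoid m ∎
    where open ≤-Reasoning

  Q P period : ℕ
  Q      = q ^ ℓ
  P      = Q ∸ 1
  period = ℓ + ℓ

  Q≥2 : 2 ≤ Q
  Q≥2 = ≤-trans q≥2 (subst (_≤ Q) (*-identityʳ q) (*-monoʳ-≤ q (^-monoʳ-≤ q {0} {ℓ′} z≤n)))

  P+1≡Q : P + 1 ≡ Q
  P+1≡Q = trans (+-comm P 1) (m+[n∸m]≡n (≤-trans (s≤s z≤n) Q≥2))

  P≥1 : 1 ≤ P
  P≥1 = +-cancelʳ-≤ 1 1 P (subst (2 ≤_) (sym P+1≡Q) Q≥2)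

  avoid≤q^ : ∀ r → avoid r ≤ q ^ r
  avoid≤q^ r = subst (avoid r ≤_) (trans (cong (q ^ r *_) avoid-zero) (*-identityʳ (q ^ r))) (avoid-growth 0 r)

  avoid-contract : ∀ n → avoid (n + ℓ) ≤ P * avoid n
  avoid-contract n = +-cancelʳ-≤ (avoid n) (avoid (n + ℓ)) (P * avoid n)
    (subst (avoid (n + ℓ) + avoid n ≤_)
      (trans (cong (_* avoid n) (sym P+1≡Q)) (solve 2 (λ p a → (p :+ con 1) :* a := p :* a :+ a) refl P (avoid n)))
      (avoid-decay n))

  avoid-contract^ : ∀ r s → avoid (r + s * ℓ) ≤ P ^ s * avoid r
  avoid-contract^ r zero    = ≤-reflexive (trans (cong avoid (+-identityʳ r)) (sym (+-identityʳ (avoid r))))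
  avoid-contract^ r (suc s) = begin
    avoid (r + (ℓ + s * ℓ))   ≡⟨ cong avoid (solve 3 (λ r l sl → r :+ (l :+ sl) := (r :+ sl) :+ l) refl r ℓ (s * ℓ)) ⟩
    avoid (r + s * ℓ + ℓ)     ≤⟨ avoid-contract (r + s * ℓ) ⟩
    P * avoid (r + s * ℓ)     ≤⟨ *-monoʳ-≤ P (avoid-contract^ r s) ⟩
    P * (P ^ s * avoid r)     ≡⟨ sym (*-assoc P (P ^ s) (avoid r)) ⟩
    P ^ suc s * avoid r       ∎
    where open ≤-Reasoning

  -- For m = r + t · period: avoid m ≤ P ^ (2t) · q ^ r by the decay, and P ^ t (P + t) ≤ P Q ^ t.
  avoid-tail : ∀ r t → avoid (r + t * period) * ((P + t) * (P + t)) ≤ (P * P) * q ^ (r + t * period)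
  avoid-tail r t = begin
    avoid (r + t * period) * ((P + t) * (P + t))
      ≡⟨ cong (λ z → avoid (r + z) * ((P + t) * (P + t))) (solve 2 (λ t l → t :* (l :+ l) := (t :+ t) :* l) refl t ℓ) ⟩
    avoid (r + (t + t) * ℓ) * ((P + t) * (P + t))
      ≤⟨ *-monoˡ-≤ ((P + t) * (P + t)) (≤-trans (avoid-contract^ r (t + t)) (*-monoʳ-≤ (P ^ (t + t)) (avoid≤q^ r))) ⟩
    P ^ (t + t) * q ^ r * ((P + t) * (P + t))
      ≡⟨ trans (cong (λ z → z * q ^ r * ((P + t) * (P + t))) (^-distribˡ-+-* P t t))
               (solve 4 (λ a b c d → a :* b :* c :* (d :* d) := c :* ((a :* d) :* (b :* d))) refl (P ^ t) (P ^ t) (q ^ r) (P + t)) ⟩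
    q ^ r * ((P ^ t * (P + t)) * (P ^ t * (P + t)))
      ≤⟨ *-monoʳ-≤ (q ^ r) (*-mono-≤ (P^t*[P+t]≤P*[P+1]^t P t) (P^t*[P+t]≤P*[P+1]^t P t)) ⟩
    q ^ r * ((P * (P + 1) ^ t) * (P * (P + 1) ^ t))
      ≡⟨ cong (λ z → q ^ r * ((P * z ^ t) * (P * z ^ t))) P+1≡Q ⟩
    q ^ r * ((P * Q ^ t) * (P * Q ^ t))
      ≡⟨ solve 4 (λ a p b c → a :* ((p :* b) :* (p :* c)) := (p :* p) :* (a :* (b :* c))) refl (q ^ r) P (Q ^ t) (Q ^ t) ⟩
    (P * P) * (q ^ r * (Q ^ t * Q ^ t))
      ≡⟨ cong (λ z → (P * P) * (q ^ r * z)) Q^t*Q^t ⟩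
    (P * P) * (q ^ r * q ^ (t * period))
      ≡⟨ cong ((P * P) *_) (sym (^-distribˡ-+-* q r (t * period))) ⟩
    (P * P) * q ^ (r + t * period) ∎
    where
    open ≤-Reasoning
    Q^t*Q^t : Q ^ t * Q ^ t ≡ q ^ (t * period)
    Q^t*Q^t = trans (sym (^-distribˡ-+-* Q t t))
      (trans (^-*-assoc q ℓ (t + t)) (cong (q ^_) (solve 2 (λ t l → l :* (t :+ t) := t :* (l :+ l)) refl t ℓ)))

  tail-bound : ∀ C r t → r < period →
    (C + (r + t * period)) * (q * avoid (r + t * period)) * suc t ≤ ((C + period) * (P * P)) * q ^ suc (r + t * period)
  tail-bound C r t r<period = begin
    (C + m) * (q * avoid m) * suc t
      ≤⟨ *-monoʳ-≤ ((C + m) * (q * avoid m)) 1+t≤P+t ⟩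
    (C + m) * (q * avoid m) * (P + t)
      ≤⟨ *-monoˡ-≤ (P + t) (*-monoˡ-≤ (q * avoid m) C+m≤) ⟩
    (C + period) * (P + t) * (q * avoid m) * (P + t)
      ≡⟨ solve 4 (λ a b q f → a :* b :* (q :* f) :* b := a :* q :* (f :* (b :* b))) refl (C + period) (P + t) q (avoid m) ⟩
    (C + period) * q * (avoid m * ((P + t) * (P + t)))
      ≤⟨ *-monoʳ-≤ ((C + period) * q) (avoid-tail r t) ⟩
    (C + period) * q * ((P * P) * q ^ m)
      ≡⟨ solve 4 (λ a q b c → a :* q :* (b :* c) := (a :* b) :* (q :* c)) refl (C + period) q (P * P) (q ^ m) ⟩
    ((C + period) * (P * P)) * q ^ suc m ∎
    where
    open ≤-Reasoning
    m = r + t * period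
    1+t≤P+t : suc t ≤ P + t
    1+t≤P+t = +-monoˡ-≤ t P≥1
    C+m≤ : C + m ≤ (C + period) * (P + t)
    C+m≤ = begin
      C + (r + t * period)
        ≤⟨ +-mono-≤ (subst (_≤ C * (P + t)) (*-identityʳ C) (*-monoʳ-≤ C (≤-trans P≥1 (m≤m+n P t))))
                    (+-monoˡ-≤ (t * period) (<⇒≤ r<period)) ⟩
      C * (P + t) + suc t * period
        ≡⟨ cong (C * (P + t) +_) (*-comm (suc t) period) ⟩
      C * (P + t) + period * suc t
        ≤⟨ +-monoʳ-≤ (C * (P + t)) (*-monoʳ-≤ period 1+t≤P+t) ⟩
      C * (P + t) + period * (P + t)
        ≡⟨ sym (*-distribʳ-+ (P + t) C period) ⟩
      (C + period) * (P + t) ∎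

  _/q^_ : ℕ → ℕ → ℚ
  a /q^ n = (a ÷ q ^ n) {{m^n≢0 q n}}

  /q^-≤ : ∀ a b c d .{{_ : NonZero d}} → a * d ≤ c * q ^ b → a /q^ b ℚ.≤ c ÷ d
  /q^-≤ a b c d = ÷-≤ a (q ^ b) c d {{m^n≢0 q b}}

  ≤-/q^ : ∀ a b c .{{_ : NonZero b}} d → a * q ^ d ≤ c * b → a ÷ b ℚ.≤ c /q^ d
  ≤-/q^ a b c {{b≢0}} d = ÷-≤ a b c (q ^ d) {{b≢0}} {{m^n≢0 q d}}

  /q^-+ : ∀ a b n → a /q^ n ℚ.+ b /q^ n ≡ (a + b) /q^ n
  /q^-+ a b n = ÷-+-same a b (q ^ n) {{m^n≢0 q n}}

  /q^-suc : ∀ a n → a /q^ n ≡ (q * a) /q^ suc n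
  /q^-suc a n = ÷-≡ a (q ^ n) (q * a) (q ^ suc n) {{m^n≢0 q n}} {{m^n≢0 q (suc n)}}
    (solve 3 (λ a q b → a :* (q :* b) := q :* a :* b) refl a q (q ^ n))

  tail→0 : ∀ C {ε} → 0ℚ ℚ.< ε → ∃ λ N → ∀ m → N ≤ m → ((C + m) * (q * avoid m)) /q^ suc m ℚ.< ε
  tail→0 C {ε} ε>0 = K * suc d * period , λ m N≤m → subst (_ ℚ.<_) (sym ε≡) (small m N≤m)
    where
    p = proj₁ (positive-fraction ε>0)
    d = proj₁ (proj₂ (positive-fraction ε>0))
    ε≡ = proj₂ (proj₂ (positive-fraction ε>0))
    K = (C + period) * (P * P)
    small : ∀ m → K * suc d * period ≤ m → ((C + m) * (q * avoid m)) /q^ suc m ℚ.< suc p ÷ suc d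
    small m N≤m = ℚ.≤-<-trans (/q^-≤ ((C + m) * (q * avoid m)) (suc m) K (suc t) tail≤) (÷-< K (suc t) (suc p) (suc d) K*d<p*t)
      where
      t = m div period
      tail≤ : (C + m) * (q * avoid m) * suc t ≤ K * q ^ suc m
      tail≤ = subst (λ z → (C + z) * (q * avoid z) * suc t ≤ K * q ^ suc z) (sym (m≡m%n+[m/n]*n m period))
                (tail-bound C (m % period) t (m%n<n m period))
      K*d<p*t : K * suc d < suc p * suc t
      K*d<p*t = <-≤-trans (s≤s (subst (_≤ t) (m*n/n≡m (K * suc d) period) (/-mono-≤ N≤m ≤-refl)))
                          (m≤n*m (suc t) (suc p))

  hitProb : ℕ → ℚ
  hitProb n = hit n /q^ n

  Σ-hitProb : ∀ m → Σℚ m hitProb ≡ mass m /q^ m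
  Σ-hitProb zero    = refl
  Σ-hitProb (suc m) = begin
    Σℚ (suc m) hitProb                  ≡⟨ Σℚ-suc hitProb m ⟩
    Σℚ m hitProb ℚ.+ hitProb m          ≡⟨ cong (ℚ._+ hitProb m) (Σ-hitProb m) ⟩
    mass m /q^ m ℚ.+ hit m /q^ m        ≡⟨ /q^-+ (mass m) (hit m) m ⟩
    (mass m + hit m) /q^ m              ≡⟨ /q^-suc (mass m + hit m) m ⟩
    mass (suc m) /q^ suc m              ∎
    where open ≡-Reasoning

  /q^-mono-≤ : ∀ {a b} n → a ≤ b → a /q^ n ℚ.≤ b /q^ n
  /q^-mono-≤ {a} {b} n a≤b = ÷-≤ a (q ^ n) b (q ^ n) {{m^n≢0 q n}} {{m^n≢0 q n}} (*-monoˡ-≤ (q ^ n) a≤b)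

  hitProb-sums-to-1 : ConvergesTo (λ m → Σℚ m hitProb) 1ℚ
  hitProb-sums-to-1 ε ε>0 = suc N , λ { (suc m) (s≤s N≤m) → close m N≤m }
    where
    N = proj₁ (tail→0 1 ε>0)
    close : ∀ m → N ≤ m → ∣ Σℚ (suc m) hitProb ℚ.- 1ℚ ∣ ℚ.< ε
    close m N≤m = subst (λ s → ∣ s ℚ.- 1ℚ ∣ ℚ.< ε) (sym (Σ-hitProb (suc m))) (∣s-r∣<ε s≤1 1≤s+e e<ε)
      where
      complement = mass-complement m
      s≤1 : mass (suc m) /q^ suc m ℚ.≤ 1ℚ
      s≤1 = /q^-≤ (mass (suc m)) (suc m) 1 1
        (subst₂ _≤_ (sym (*-identityʳ (mass (suc m)))) (sym (+-identityʳ (q ^ suc m)))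
          (≤-trans (m≤m+n (mass (suc m)) (q * avoid m)) (≤-reflexive complement)))
      1≤s+e : 1ℚ ℚ.≤ mass (suc m) /q^ suc m ℚ.+ (q * avoid m) /q^ suc m
      1≤s+e = subst (1ℚ ℚ.≤_) (sym (/q^-+ (mass (suc m)) (q * avoid m) (suc m)))
        (≤-/q^ 1 1 (mass (suc m) + q * avoid m) (suc m)
          (≤-reflexive (trans (+-identityʳ _) (trans (sym complement) (sym (*-identityʳ _))))))
      e<ε : (q * avoid m) /q^ suc m ℚ.< ε
      e<ε = ℚ.≤-<-trans (/q^-mono-≤ (suc m) (m≤m+n (q * avoid m) (m * (q * avoid m)))) (proj₂ (tail→0 1 ε>0) m N≤m)

  n*hitProb : ∀ n → (n ÷ 1) ℚ.* hitProb n ≡ (n * hit n) /q^ n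
  n*hitProb n = trans (÷-* n 1 (hit n) (q ^ n) {{_}} {{m^n≢0 q n}})
    (÷-≡ (n * hit n) (1 * q ^ n) (n * hit n) (q ^ n) {{m*n≢0 1 (q ^ n) {{_}} {{m^n≢0 q n}}}} {{m^n≢0 q n}}
      (cong (n * hit n *_) (sym (*-identityˡ (q ^ n)))))

  Σ-n*hitProb : ∀ m → Σℚ m (λ n → (n ÷ 1) ℚ.* hitProb n) ≡ moment m /q^ m
  Σ-n*hitProb zero    = refl
  Σ-n*hitProb (suc m) = begin
    Σℚ (suc m) (λ n → (n ÷ 1) ℚ.* hitProb n)                  ≡⟨ Σℚ-suc (λ n → (n ÷ 1) ℚ.* hitProb n) m ⟩
    Σℚ m (λ n → (n ÷ 1) ℚ.* hitProb n) ℚ.+ (m ÷ 1) ℚ.* hitProb m ≡⟨ cong₂ ℚ._+_ (Σ-n*hitProb m) (n*hitProb m) ⟩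
    moment m /q^ m ℚ.+ (m * hit m) /q^ m                       ≡⟨ /q^-+ (moment m) (m * hit m) m ⟩
    (moment m + m * hit m) /q^ m                               ≡⟨ /q^-suc (moment m + m * hit m) m ⟩
    moment (suc m) /q^ suc m                                   ∎
    where open ≡-Reasoning

  moment-≤ : ∀ m → moment (suc m) * |G| ≤ waitNumerator * q ^ suc m
  moment-≤ m = begin
    moment (suc m) * |G|
      ≤⟨ *-monoˡ-≤ |G| (≤-trans (m≤m+n (moment (suc m)) (q * (m * avoid m))) (≤-reflexive (moment-complement m))) ⟩
    q * avoidMass m * |G|
      ≡⟨ solve 3 (λ q x g → q :* x :* g := q :* (g :* x)) refl q (avoidMass m) |G| ⟩
    q * (|G| * avoidMass m)
      ≤⟨ *-monoʳ-≤ q (≤-trans (m≤m+n _ (q * overshoot m)) (≤-reflexive (conway-complement m))) ⟩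
    q * (q ^ m * waitNumerator)
      ≡⟨ solve 3 (λ q a r → q :* (a :* r) := r :* (q :* a)) refl q (q ^ m) waitNumerator ⟩
    waitNumerator * q ^ suc m ∎
    where open ≤-Reasoning

  moment-≥ : ∀ m → waitNumerator * q ^ suc m ≤ (moment (suc m) + (waitNumerator + m) * (q * avoid m)) * |G|
  moment-≥ m = begin
    waitNumerator * q ^ suc m
      ≡⟨ solve 3 (λ q a r → r :* (q :* a) := q :* (a :* r)) refl q (q ^ m) waitNumerator ⟩
    q * (q ^ m * waitNumerator)
      ≡⟨ cong (q *_) (sym (conway-complement m)) ⟩
    q * (|G| * avoidMass m + q * overshoot m)
      ≤⟨ *-monoʳ-≤ q (+-monoʳ-≤ (|G| * avoidMass m) (overshoot-≤ m)) ⟩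
    q * (|G| * avoidMass m + waitNumerator * avoid m)
      ≡⟨ solve 5 (λ q g x r f → q :* (g :* x :+ r :* f) := g :* (q :* x) :+ q :* (r :* f))
                 refl q |G| (avoidMass m) waitNumerator (avoid m) ⟩
    |G| * (q * avoidMass m) + q * (waitNumerator * avoid m)
      ≡⟨ cong (λ z → |G| * z + q * (waitNumerator * avoid m)) (sym (moment-complement m)) ⟩
    |G| * (moment (suc m) + q * (m * avoid m)) + q * (waitNumerator * avoid m)
      ≤⟨ +-monoʳ-≤ (|G| * (moment (suc m) + q * (m * avoid m))) (m≤n*m (q * (waitNumerator * avoid m)) |G|) ⟩
    |G| * (moment (suc m) + q * (m * avoid m)) + |G| * (q * (waitNumerator * avoid m))
      ≡⟨ solve 6 (λ g z q m f r → g :* (z :+ q :* (m :* f)) :+ g :* (q :* (r :* f)) := (z :+ (r :+ m) :* (q :* f)) :* g)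
               refl |G| (moment (suc m)) q m (avoid m) waitNumerator ⟩
    (moment (suc m) + (waitNumerator + m) * (q * avoid m)) * |G| ∎
    where open ≤-Reasoning

  mean-converges : ConvergesTo (λ m → Σℚ m (λ n → (n ÷ 1) ℚ.* hitProb n)) (waitNumerator ÷ |G|)
  mean-converges ε ε>0 = suc N , λ { (suc m) (s≤s N≤m) → close m N≤m }
    where
    N = proj₁ (tail→0 waitNumerator ε>0)
    close : ∀ m → N ≤ m → ∣ Σℚ (suc m) (λ n → (n ÷ 1) ℚ.* hitProb n) ℚ.- waitNumerator ÷ |G| ∣ ℚ.< ε
    close m N≤m = subst (λ s → ∣ s ℚ.- waitNumerator ÷ |G| ∣ ℚ.< ε) (sym (Σ-n*hitProb (suc m)))
      (∣s-r∣<ε (/q^-≤ (moment (suc m)) (suc m) waitNumerator |G| (moment-≤ m))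
               (subst (waitNumerator ÷ |G| ℚ.≤_) (sym (/q^-+ (moment (suc m)) tail (suc m)))
                      (≤-/q^ waitNumerator |G| (moment (suc m) + tail) (suc m) (moment-≥ m)))
               (proj₂ (tail→0 waitNumerator ε>0) m N≤m))
      where
      tail = (waitNumerator + m) * (q * avoid m)

converges-if-eventually : ∀ {s r} N → (∀ m → N ≤ m → s m ≡ r) → ConvergesTo s r
converges-if-eventually {s} {r} N s≡r ε ε>0 = N , λ m N≤m →
  subst (λ x → ∣ x ℚ.- r ∣ ℚ.< ε) (sym (s≡r m N≤m)) (subst (ℚ._< ε) (sym (cong ∣_∣ (ℚ.+-inverseʳ r))) ε>0)

module EmptyPattern {q : ℕ} .{{_ : NonZero q}} (G : FiniteSubgroup q) where

  always-ends : ∀ u → T (endsInPattern G [] u)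
  always-ends u with k , k∈ , _ ← find (has-id G) =
    subst (T ∘ inOrbit G []) (sym (drop-all (length u) u ≤-refl)) (any⁺ _ (Any.map (λ { refl → _ }) k∈))

  firstHit-[] : firstHit G [] [] ≡ true
  firstHit-[] = cong (_∧ true) (Equivalence.to T-≡ (always-ends []))

  firstHit-∷ : ∀ a u → firstHit G [] (a ∷ u) ≡ false
  firstHit-∷ a u = trans
    (cong (λ b → endsInPattern G [] (a ∷ u) ∧ not b)
      (trans (any-take≡anyProperPrefix (endsInPattern G []) (a ∷ u))
             (cong (_∨ anyProperPrefix (endsInPattern G [] ∘ (a ∷_)) u) (Equivalence.to T-≡ (always-ends [])))))
    (∧-zeroʳ (endsInPattern G [] (a ∷ u)))

  probT-zero : probT G [] 0 ≡ 1ℚ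
  probT-zero = cong (_÷ 1) (trans (length-filter≡∑ (T? ∘ firstHit G []) (words q 0)) (cong (λ b → 𝟙 b + 0) firstHit-[]))

  probT-suc : ∀ n → probT G [] (suc n) ≡ 0ℚ
  probT-suc n = trans (cong (λ c → (c ÷ q ^ suc n) {{m^n≢0 q (suc n)}}) no-hits) (ℚ.0/n≡0 (q ^ suc n) {{m^n≢0 q (suc n)}})
    where
    open WordSums q
    no-hits : length (filterᵇ (firstHit G []) (words q (suc n))) ≡ 0
    no-hits = trans (length-filter≡∑ (T? ∘ firstHit G []) (words q (suc n)))
      (trans (∑ʷ-cong (suc n) (λ { (a ∷ u) _ → cong 𝟙 (firstHit-∷ a u) })) (∑-zero (words q (suc n))))

  Σ-probT : ∀ m → Σℚ (suc m) (probT G []) ≡ 1ℚ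
  Σ-probT zero    = trans (Σℚ-suc (probT G []) 0) (trans (ℚ.+-identityˡ _) probT-zero)
  Σ-probT (suc m) = trans (Σℚ-suc (probT G []) (suc m))
    (trans (cong₂ ℚ._+_ (Σ-probT m) (probT-suc m)) (ℚ.+-identityʳ 1ℚ))

  Σ-n*probT : ∀ m → Σℚ m (λ n → (n ÷ 1) ℚ.* probT G [] n) ≡ 0ℚ
  Σ-n*probT zero    = refl
  Σ-n*probT (suc m) = trans (Σℚ-suc (λ n → (n ÷ 1) ℚ.* probT G [] n) m)
    (trans (cong₂ ℚ._+_ (Σ-n*probT m) (term m)) (ℚ.+-identityʳ 0ℚ))
    where
    term : ∀ n → (n ÷ 1) ℚ.* probT G [] n ≡ 0ℚ
    term zero    = ℚ.*-zeroˡ (probT G [] 0)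
    term (suc n) = trans (cong ((suc n ÷ 1) ℚ.*_) (probT-suc n)) (ℚ.*-zeroʳ (suc n ÷ 1))

  wait : ExpectedWait G [] 0ℚ
  wait = converges-if-eventually {s = λ m → Σℚ m (probT G [])} 1 (λ { (suc m) _ → Σ-probT m })
       , converges-if-eventually {s = λ m → Σℚ m (λ n → (n ÷ 1) ℚ.* probT G [] n)} 0 (λ m _ → Σ-n*probT m)

meanWait : ∀ {q} → FiniteSubgroup q → Fin q → Word q → ℚ
meanWait G a w′ = (Pattern.waitNumerator G a w′ ÷ order G) {{order-nonZero G}}

expectedWait : ∀ {q} .{{_ : NonZero q}} → 2 ≤ q → (G : FiniteSubgroup q) (a : Fin q) (w′ : Word q) →
  ExpectedWait G (a ∷ w′) (meanWait G a w′)
expectedWait {q} q≥2 G a w′ = hitProb-sums-to-1 , mean-converges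
  where
  open Pattern G a w′
  open WaitingTime q q≥2 (length w′) #avoiding #hitting correlation (order G) {{order-nonZero G}}
    avoid-step #avoiding-zero #hitting-early conway avoiding-decay
    using (hitProb-sums-to-1; mean-converges)

module _ {q : ℕ} (G : FiniteSubgroup q) (x : Fin q) where

  private instance
    |G|≢0 : NonZero (order G)
    |G|≢0 = order-nonZero G

  bound-÷ : ∀ ℓ → bound G x ℓ ≡ (stabOrder G x * geomSum q ℓ) ÷ order G
  bound-÷ ℓ = trans (÷-* (stabOrder G x) (order G) (geomSum q ℓ) 1)
    (÷-≡ (stabOrder G x * geomSum q ℓ) (order G * 1) (stabOrder G x * geomSum q ℓ) (order G) {{m*n≢0 (order G) 1}}
         (cong (stabOrder G x * geomSum q ℓ *_) (sym (*-identityʳ (order G)))))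

  meanWait-≤ : (∀ y → stabOrder G y ≤ stabOrder G x) → ∀ a w′ → meanWait G a w′ ℚ.≤ bound G x (suc (length w′))
  meanWait-≤ x-max a w′ = subst (meanWait G a w′ ℚ.≤_) (sym (bound-÷ ℓ))
    (÷-≤ waitNumerator (order G) (stabOrder G x * geomSum q ℓ) (order G) (*-monoˡ-≤ (order G) scaled≤))
    where
    open Pattern G a w′ using (ℓ; correlation; correlation-≤; waitNumerator)
    scaled≤ : waitNumerator ≤ stabOrder G x * geomSum q ℓ
    scaled≤ = ≤-trans (∑-mono-∈ (upTo ℓ) (λ k k∈ → *-monoˡ-≤ (q ^ suc k) (correlation-≤ x-max (suc k) z<s (∈-upTo⁻ k∈))))
                      (≤-reflexive (∑-*ˡ (stabOrder G x) (upTo ℓ) (λ k → q ^ suc k)))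

  meanWait-replicate : ∀ n → meanWait G x (replicate n x) ≡ bound G x (suc n)
  meanWait-replicate n = trans (cong (_÷ order G) scaled≡) (sym (bound-÷ (suc n)))
    where
    open Pattern G x (replicate n x) using (correlation; waitNumerator)
    scaled≡ : waitNumerator ≡ stabOrder G x * geomSum q (suc n)
    scaled≡ = trans (cong (λ m → ∑[ k ← upTo (suc m) ] correlation (suc k) * q ^ suc k) (length-replicate n))
      (trans (∑-cong-∈ (upTo (suc n)) (λ k k∈ → cong (_* q ^ suc k) (correlation-replicate G x n (suc k) z<s (∈-upTo⁻ k∈))))
             (∑-*ˡ (stabOrder G x) (upTo (suc n)) (λ k → q ^ suc k)))

  bound-zero : bound G x 0 ≡ 0ℚ
  bound-zero = ℚ.*-zeroʳ (stabOrder G x ÷ order G)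

mainTheorem13 : (q : ℕ) .{{_ : NonZero q}} → 2 ≤ q →
    (G : FiniteSubgroup q) (x : Fin q) →
    (∀ (y : Fin q) → stabOrder G y ≤ stabOrder G x) →
    (ℓ : ℕ) →
    ((w : Word q) → length w ≡ ℓ →
      Σ ℚ (λ r → ExpectedWait G w r × r ℚ.≤ bound G x ℓ))
    × ExpectedWait G (replicate ℓ x) (bound G x ℓ)
mainTheorem13 q q≥2 G x x-max ℓ =
  (λ w |w|≡ℓ → subst (λ n → Σ ℚ (λ r → ExpectedWait G w r × r ℚ.≤ bound G x n)) |w|≡ℓ (wait-≤-bound w)) , xs-wait ℓ
  where
  wait-≤-bound : (w : Word q) → Σ ℚ (λ r → ExpectedWait G w r × r ℚ.≤ bound G x (length w))
  wait-≤-bound []       = 0ℚ , EmptyPattern.wait G , ℚ.≤-reflexive (sym (bound-zero G x))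
  wait-≤-bound (a ∷ w′) = meanWait G a w′ , expectedWait q≥2 G a w′ , meanWait-≤ G x x-max a w′

  xs-wait : ∀ ℓ → ExpectedWait G (replicate ℓ x) (bound G x ℓ)
  xs-wait zero    = subst (ExpectedWait G []) (sym (bound-zero G x)) (EmptyPattern.wait G)
  xs-wait (suc n) =
    subst (ExpectedWait G (replicate (suc n) x)) (meanWait-replicate G x n) (expectedWait q≥2 G x (replicate n x))
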